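{- Let $r\ge2$, let $P_1,\dots,P_{3^{r-1}}$ be all the collectable $r$-patterns, and let $x_1,\dots,x_{3^{r-1}}$ be positive real numbers. If $n>\prod_{i=1}^{3^{r-1}}x_i$, then every ordered $r$-matching of size $n$ contains a $P_i$-clique of size greater than $x_i2^{ -m(P_i)}$, for some $i\in[3^{r-1}]$.
   Context: An ordered $r$-matching of size $n$ is a set of $n$ pairwise disjoint $r$-element subsets (edges) of $[rn]$ covering $[rn]$, considered up to order-isomorphism. An $r$-pattern is an ordered $r$-matching of size two, written as a word in letters $A,B$ each occurring $r$ times. Two edges form pattern $P$ if with the induced order they are order-isomorphic to $P$. A $P$-clique is a matching in which every pair of edges forms $P$; by convention a single edge forms a $P$-clique for every $r$-pattern $P$. $P$ is collectable if $P$-cliques of every size $k\ge2$ exist. The maturity $m(P)$ of a collectable pattern is the length of the last maximal run of equal letters in its word minus $2$, or $0$ if this is negative.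
   Formalization: The positive numbers $x_1,\dots,x_{3^{r-1}}$ are rational rather than real. -}

module Defs where

open import Data.Nat using (ℕ; zero; suc; _+_; _*_; _∸_; _≤_)
open import Data.Bool using (Bool; true; false; if_then_else_; _∨_; T?)
open import Data.Fin using (Fin) renaming (zero to fzero; suc to fsuc)
open import Data.Fin.Properties using (_≟_)
open import Data.List using (List; []; _∷_; filter; map; length; reverse)
open import Data.List.Base using (allFin)
open import Data.Product using (Σ; ∃; _×_)
open import Data.Sum using (_⊎_)
open import Data.Integer using (+_)
open import Data.Rational using (ℚ; _/_; 1ℚ; ½) renaming (_*_ to _*ℚ_)
open import Relation.Nullary.Decidable using (⌊_⌋)
open import Relation.Binary.PropositionalEquality using (_≡_; _≢_)

-- Letters of a word: true = A, false = B.

countB : Bool → List Bool → ℕ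
countB b [] = 0
countB true  (true ∷ w)  = suc (countB true w)
countB true  (false ∷ w) = countB true w
countB false (false ∷ w) = suc (countB false w)
countB false (true ∷ w)  = countB false w

-- An r-pattern: a word in A,B with each letter occurring r times,
-- written in canonical form (the first letter is A, i.e. the edge containing the
-- smallest vertex is called A), so that each ordered 2-matching has exactly one word.
IsPattern : ℕ → List Bool → Set
IsPattern r [] = 0 ≡ 1
IsPattern r (b ∷ w) = (b ≡ true) × (countB true (b ∷ w) ≡ r) × (countB false (b ∷ w) ≡ r)

-- An (ordered) r-matching of size n on the vertex set [rn] = Fin (r * n):
-- the map assigns to each vertex the (label of the) edge containing it; each of the
-- n edges has exactly r vertices.  The linear order is the order of Fin (r * n).
IsMatching : (r n : ℕ) → (Fin (r * n) → Fin n) → Set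
IsMatching r n M = ∀ (e : Fin n) → length (filter (λ i → M i ≟ e) (allFin (r * n))) ≡ r

pairWord : {N n : ℕ} → (Fin N → Fin n) → Fin n → Fin n → List Bool
pairWord {N} M e f =
  map (λ i → ⌊ M i ≟ e ⌋)
      (filter (λ i → T? (⌊ M i ≟ e ⌋ ∨ ⌊ M i ≟ f ⌋)) (allFin N))

Forms : {N n : ℕ} → (Fin N → Fin n) → Fin n → Fin n → List Bool → Set
Forms M e f P = (pairWord M e f ≡ P) ⊎ (pairWord M f e ≡ P)

Collectable : ℕ → List Bool → Set
Collectable r P = ∀ (k : ℕ) → 2 ≤ k →
  Σ (Fin (r * k) → Fin k) λ M → IsMatching r k M × (∀ e f → e ≢ f → Forms M e f P)

runFrom : Bool → List Bool → ℕ
runFrom b [] = 0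
runFrom true  (true ∷ w)  = suc (runFrom true w)
runFrom false (false ∷ w) = suc (runFrom false w)
runFrom true  (false ∷ w) = 0
runFrom false (true ∷ w)  = 0

firstRun : List Bool → ℕ
firstRun [] = 0
firstRun (b ∷ w) = suc (runFrom b w)

lastRun : List Bool → ℕ
lastRun w = firstRun (reverse w)

maturity : List Bool → ℕ
maturity P = lastRun P ∸ 2

pow½ : ℕ → ℚ
pow½ zero = 1ℚ
pow½ (suc m) = ½ *ℚ pow½ m

prodℚ : (k : ℕ) → (Fin k → ℚ) → ℚ
prodℚ zero x = 1ℚ
prodℚ (suc k) x = x fzero *ℚ prodℚ k (λ i → x (fsuc i))

ℕtoℚ : ℕ → ℚ
ℕtoℚ n = + n / 1

{-# OPTIONS --safe #-}
-- Every collectable r-pattern is a sequence of blocks A^t B^t or B^t A^t, the first one starting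
-- with A. Reading two edges from left to right, each further vertex lengthens the current block or
-- opens a block of the same or of the opposite orientation, so these patterns are the 3^(r-1)
-- leaves of a ternary tree of shapes. Start with all n edges, ordered by their first vertex, and
-- refine a clique realising the shape at a node by comparing the next vertex of every pair: two
-- applications of Mirsky's theorem (a long chain or a large antichain) turn a clique larger than
-- a·b·c into one larger than a, b or c for one of the three children. Opening a block of the same
-- orientation after a block of length at least 2 needs a third edge as a witness for each pair,
-- which costs a factor 2. Along the tree these sizes multiply: if the leaf P only has to beat
-- c_P = ⌊x_P 2^-m(P)⌋, then ∏ c_P 2^m(P) ≤ ∏ x_P < n edges suffice.
module Submission where

open import Defs
open import Data.Bool using (Bool; true; false; not; T; _∧_; _∨_; _xor_; if_then_else_)
open import Data.Bool.Properties using (T?; not-injective; xor-same)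
open import Data.Empty using (⊥)
open import Data.Fin as Fin using (Fin; toℕ; cast; splitAt; punchOut; _↑ˡ_; _↑ʳ_) renaming (zero to fzero; suc to fsuc)
open import Data.Fin.Permutation using (permutation)
open import Data.Fin.Properties using (_≟_; any?; <-cmp; <⇒≢; cast-is-id; toℕ-injective; injective⇒≤; punchOut-injective;
  splitAt-↑ˡ; splitAt-↑ʳ; splitAt⁻¹-↑ˡ; splitAt⁻¹-↑ʳ)
open import Data.Integer as ℤ using (+_; -[1+_]; +≤+; +<+)
import Data.Integer.Properties as ℤ
open import Data.List using (List; []; _∷_; [_]; _++_; length; map; replicate; reverse; head; concatMap; filter; filterᵇ;
  allFin; lookup; tabulate; initLast; _∷ʳ′_)
open import Data.List.Membership.Propositional using (_∈_; find)
open import Data.List.Membership.Propositional.Properties using (∈-map⁺; ∈-map⁻; ∈-filter⁺; ∈-filter⁻; ∈-allFin)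
open import Data.List.Properties using (filter-++; filter-none; map-++; map-∘; map-cong; map-cong-local; map-replicate; map-tabulate;
  length-++; length-map; length-replicate; length-reverse; length-tabulate; tabulate-lookup; unfold-reverse;
  reverse-++; ++-assoc; ++-identityʳ; ++-cancelˡ)
open import Data.List.Relation.Binary.Sublist.Propositional using (_⊆_; []; _∷_; _∷ʳ_; ⊆-trans; minimum; from∈)
open import Data.List.Relation.Binary.Sublist.Propositional.Properties using (All-resp-⊆)
open import Data.List.Relation.Unary.All as All using (All; []; _∷_)
open import Data.List.Relation.Unary.All.Properties as All using (¬Any⇒All¬; ++⁻; all-filter)
open import Data.List.Relation.Unary.AllPairs as AllPairs using (AllPairs; []; _∷_)
open import Data.List.Relation.Unary.AllPairs.Properties as AllPairs using ()
open import Data.List.Relation.Unary.Any as Any using (here; there)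
open import Data.List.Relation.Unary.Any.Properties using (lookup-index)
open import Data.List.Relation.Unary.Linked as Linked using (Linked; []; [-]; _∷_)
open import Data.List.Relation.Unary.Linked.Properties using (AllPairs⇒Linked)
open import Data.List.Relation.Unary.Unique.Propositional using (Unique)
open import Data.Maybe.Properties using (just-injective)
open import Data.Nat using (ℕ; zero; suc; _+_; _*_; _∸_; _^_; _≤_; _<_; z≤n; s≤s; _<?_; _<ᵇ_)
open import Data.Nat.DivMod using (_/_; _%_; m/n*n≤m; m≡m%n+[m/n]*n; m%n<n)
open import Data.Nat.Properties using (*-1-commutativeMonoid; *-assoc; *-distribʳ-+; *-identityʳ; *-suc; *-zeroʳ;
  +-cancelˡ-<; +-comm; +-identityʳ; +-monoˡ-≤; +-suc; <-asym; <-irrefl; <-trans; <-≤-trans; <ᵇ⇒<; <⇒<ᵇ; <⇒≤;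
  m<m+n; m≤m+n; m≤n+m; m≤n⇒m<n∨m≡n; n<1+n; ≤-<-trans; ≤-pred; ≤-refl; ≤-reflexive; ≤-trans; ≤∧≢⇒<; ≮⇒≥)
  renaming (_≟_ to _≟ℕ_)
open import Algebra.Properties.CommutativeMonoid.Sum *-1-commutativeMonoid
  using () renaming (sum to ∏; sum-cong-≗ to ∏-cong; sum-permute to ∏-permute)
open import Data.Nat.Solver using (module +-*-Solver)
open import Data.Product using (Σ; ∃; _×_; _,_; proj₁; proj₂)
open import Data.Rational using (ℚ; mkℚ; 0ℚ; 1ℚ; ½; NonNegative; Positive)
  renaming (_≤_ to _≤ℚ_; _<_ to _<ℚ_; _*_ to _*ℚ_)
import Data.Rational as ℚ
open import Data.Rational.Literals using (fromℤ)
import Data.Rational.Properties as ℚ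
open import Data.Sum using (_⊎_; inj₁; inj₂)
open import Data.Unit using (⊤; tt)
open import Function using (_∘_; id; _⟨_⟩_)
open import Function.Definitions using (Injective)
open import Level using (_⊔_)
open import Relation.Binary using (Rel; Decidable; tri<; tri≈; tri>)
open import Relation.Binary.Construct.Intersection using (_∩_)
open import Relation.Binary.PropositionalEquality
  using (_≡_; _≢_; _≗_; refl; sym; trans; cong; cong₂; subst; subst₂; module ≡-Reasoning)
open import Relation.Nullary using (¬_; Dec; yes; no; does; contradiction)
open import Relation.Nullary.Decidable using (dec-true; dec-false; isYes≗does)

-- Chains and antichains

_∖_ : ∀ {a ℓ₁ ℓ₂} {X : Set a} → Rel X ℓ₁ → Rel X ℓ₂ → Rel X (ℓ₁ ⊔ ℓ₂)
(K ∖ R) x y = K x y × ¬ R x y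

module _ {a ℓ} {X : Set a} {R : Rel X ℓ} where

  AllPairs-resp-⊆ : ∀ {xs ys} → xs ⊆ ys → AllPairs R ys → AllPairs R xs
  AllPairs-resp-⊆ [] [] = []
  AllPairs-resp-⊆ (y ∷ʳ τ) (_ ∷ rys) = AllPairs-resp-⊆ τ rys
  AllPairs-resp-⊆ (refl ∷ τ) (ry ∷ rys) = All-resp-⊆ τ ry ∷ AllPairs-resp-⊆ τ rys

  AllPairs-∈ : ∀ {xs x y} → AllPairs R xs → x ∈ xs → y ∈ xs → x ≢ y → R x y ⊎ R y x
  AllPairs-∈ (_ ∷ _) (here refl) (here refl) x≢y = contradiction refl x≢y
  AllPairs-∈ (Rx ∷ _) (here refl) (there y∈) _ = inj₁ (All.lookup Rx y∈)
  AllPairs-∈ (Ry ∷ _) (there x∈) (here refl) _ = inj₂ (All.lookup Ry x∈)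
  AllPairs-∈ (_ ∷ Rxs) (there x∈) (there y∈) x≢y = AllPairs-∈ Rxs x∈ y∈ x≢y

  AllPairs-∷ʳ⁻ : ∀ xs {w} → AllPairs R (xs ++ [ w ]) → All (λ v → R v w) xs
  AllPairs-∷ʳ⁻ [] _ = []
  AllPairs-∷ʳ⁻ (x ∷ xs) (Rx ∷ Rxs) = All.head (proj₂ (++⁻ xs Rx)) ∷ AllPairs-∷ʳ⁻ xs Rxs

Clique> : ∀ {a ℓ} {X : Set a} → Rel X ℓ → ℕ → Set (a ⊔ ℓ)
Clique> R b = ∃ λ S → AllPairs R S × b < length S

2*suc<suc⇒suc< : ∀ {b n} → 2 * suc b < suc n → suc b < n
2*suc<suc⇒suc< {b} (s≤s 2b≤n) = <-≤-trans (m<m+n (suc b) (s≤s z≤n)) 2b≤n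

module _ {a ℓ₁ ℓ₂} {X : Set a} {T : Rel X ℓ₁} {U : Rel X ℓ₂} where

  AllPairs-dropLast : (∀ {u v w} → T u v → T v w → T u w → U u v) →
    ∀ xs {w} → AllPairs T (xs ++ [ w ]) → AllPairs U xs
  AllPairs-dropLast triangle [] _ = []
  AllPairs-dropLast triangle (x ∷ xs) (Tx ∷ Txs) with ++⁻ xs Tx
  ... | Txv , Txw ∷ [] = All.zipWith (λ (Txv , Tvw) → triangle Txv Tvw Txw) (Txv , AllPairs-∷ʳ⁻ xs Txs)
                         ∷ AllPairs-dropLast triangle xs Txs

  Clique>-dropLast : (∀ {u v w} → T u v → T v w → T u w → U u v) → ∀ b → Clique> T (2 * b) → Clique> U b
  Clique>-dropLast triangle b (S , TS , 2b<S) with initLast S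
  Clique>-dropLast triangle zero _ | xs ∷ʳ′ w = [ w ] , [] ∷ [] , s≤s z≤n
  Clique>-dropLast triangle (suc b) (_ , TS , 2b<S) | xs ∷ʳ′ w =
    xs , AllPairs-dropLast triangle xs TS ,
    2*suc<suc⇒suc< (subst (2 * suc b <_) (trans (length-++ xs) (+-comm _ 1)) 2b<S)

  Clique>-dropHead : (∀ {w u v} → T w u → T w v → T u v → U u v) → ∀ b → Clique> T (2 * b) → Clique> U b
  Clique>-dropHead triangle zero (w ∷ _ , _ , _) = [ w ] , [] ∷ [] , s≤s z≤n
  Clique>-dropHead triangle (suc b) (w ∷ xs , Tw ∷ Txs , 2b<S) =
    xs , dropHead Tw Txs , 2*suc<suc⇒suc< 2b<S
    where
    dropHead : ∀ {ys} → All (T w) ys → AllPairs T ys → AllPairs U ys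
    dropHead [] [] = []
    dropHead (Twy ∷ Tws) (Ty ∷ Tys) = All.zipWith (λ (Twz , Tyz) → triangle Twy Twz Tyz) (Tws , Ty) ∷ dropHead Tws Tys

module ChainOrAntichain {a ℓ} {X : Set a} (K R : Rel X ℓ) (R? : Decidable R)
  (R-trans : ∀ {x y z} → K x y → K y z → K x z → R x y → R y z → R x z) where

  maximals nonMaximals : List X → List X
  maximals [] = []
  maximals (x ∷ xs) with Any.any? (R? x) xs
  ... | yes _ = maximals xs
  ... | no _ = x ∷ maximals xs
  nonMaximals [] = []
  nonMaximals (x ∷ xs) with Any.any? (R? x) xs
  ... | yes _ = x ∷ nonMaximals xs
  ... | no _ = nonMaximals xs

  length-maximals+nonMaximals : ∀ xs → length (maximals xs) + length (nonMaximals xs) ≡ length xs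
  length-maximals+nonMaximals [] = refl
  length-maximals+nonMaximals (x ∷ xs) with Any.any? (R? x) xs
  ... | yes _ = trans (+-suc _ _) (cong suc (length-maximals+nonMaximals xs))
  ... | no _ = cong suc (length-maximals+nonMaximals xs)

  maximals-⊆ : ∀ xs → maximals xs ⊆ xs
  maximals-⊆ [] = []
  maximals-⊆ (x ∷ xs) with Any.any? (R? x) xs
  ... | yes _ = x ∷ʳ maximals-⊆ xs
  ... | no _ = refl ∷ maximals-⊆ xs

  nonMaximals-⊆ : ∀ xs → nonMaximals xs ⊆ xs
  nonMaximals-⊆ [] = []
  nonMaximals-⊆ (x ∷ xs) with Any.any? (R? x) xs
  ... | yes _ = refl ∷ nonMaximals-⊆ xs
  ... | no _ = x ∷ʳ nonMaximals-⊆ xs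

  maximals-antichain : ∀ xs → AllPairs (λ x y → ¬ R x y) (maximals xs)
  maximals-antichain [] = []
  maximals-antichain (x ∷ xs) with Any.any? (R? x) xs
  ... | yes _ = maximals-antichain xs
  ... | no ¬Rx = All-resp-⊆ (maximals-⊆ xs) (¬Any⇒All¬ xs ¬Rx) ∷ maximals-antichain xs

  -- The last element of a chain of non-maximal elements has an R-successor further on.
  extend : ∀ xs c cs → c ∷ cs ⊆ nonMaximals xs → Linked R (c ∷ cs) →
    ∃ λ cs′ → c ∷ cs′ ⊆ xs × Linked R (c ∷ cs′) × length cs′ ≡ suc (length cs)
  extend (x ∷ xs) c cs τ chain with Any.any? (R? x) xs
  extend (x ∷ xs) c cs (.x ∷ʳ τ) chain | yes _ with extend xs c cs τ chain
  ... | cs′ , τ′ , chain′ , len = cs′ , x ∷ʳ τ′ , chain′ , len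
  extend (x ∷ xs) .x [] (refl ∷ τ) chain | yes Rx with find Rx
  ... | y , y∈xs , Rxy = [ y ] , refl ∷ from∈ y∈xs , Rxy ∷ [-] , refl
  extend (x ∷ xs) .x (c ∷ cs) (refl ∷ τ) (Rxc ∷ chain) | yes _ with extend xs c cs τ chain
  ... | cs′ , τ′ , chain′ , len = c ∷ cs′ , refl ∷ τ′ , Rxc ∷ chain′ , cong suc len
  extend (x ∷ xs) c cs τ chain | no _ with extend xs c cs τ chain
  ... | cs′ , τ′ , chain′ , len = cs′ , x ∷ʳ τ′ , chain′ , len

  linked⇒chain : ∀ {xs} → AllPairs K xs → Linked R xs → AllPairs (K ∩ R) xs
  linked⇒chain [] _ = []
  linked⇒chain (Kx ∷ Kxs) chain = All.zip (Kx , head-below Kx Kxs chain) ∷ linked⇒chain Kxs (Linked.tail chain)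
    where
    head-below : ∀ {x xs} → All (K x) xs → AllPairs K xs → Linked R (x ∷ xs) → All (R x) xs
    head-below [] _ _ = []
    head-below (Kxy ∷ Kxs) (Ky ∷ Kys) (Rxy ∷ chain) =
      Rxy ∷ All.zipWith (λ { (Ryz , Kxz , Kyz) → R-trans Kxy Kyz Kxz Rxy Ryz })
                        (head-below Ky Kys chain , All.zip (Kxs , Ky))

  chain-or-antichain : ∀ a b E → AllPairs K E → a * b < length E →
    (∃ λ S → S ⊆ E × AllPairs (K ∩ R) S × a < length S) ⊎
    (∃ λ S → S ⊆ E × AllPairs (K ∖ R) S × b < length S)
  chain-or-antichain zero b (x ∷ E) _ _ = inj₁ ([ x ] , refl ∷ minimum E , [] ∷ [] , s≤s z≤n)
  chain-or-antichain (suc a) b E KE ab<E with b <? length (maximals E)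
  ... | yes b<max = inj₂ (maximals E , maximals-⊆ E ,
          AllPairs.zip (AllPairs-resp-⊆ (maximals-⊆ E) KE , maximals-antichain E) , b<max)
  ... | no b≮max with chain-or-antichain a b (nonMaximals E) (AllPairs-resp-⊆ (nonMaximals-⊆ E) KE) ab<nonMax
    where
    ab<nonMax : a * b < length (nonMaximals E)
    ab<nonMax = +-cancelˡ-< b _ _ (≤-trans ab<E (≤-trans (≤-reflexive (sym (length-maximals+nonMaximals E)))
                  (+-monoˡ-≤ _ (≮⇒≥ b≮max))))
  ... | inj₂ (S , τ , antichain , b<S) = inj₂ (S , ⊆-trans τ (nonMaximals-⊆ E) , antichain , b<S)
  ... | inj₁ (c ∷ cs , τ , chain , a<S) with extend E c cs τ (AllPairs⇒Linked (AllPairs.map (λ (_ , Rxy) → Rxy) chain))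
  ... | cs′ , τ′ , chain′ , len = inj₁ (c ∷ cs′ , τ′ , linked⇒chain (AllPairs-resp-⊆ τ′ KE) chain′ ,
          subst (λ l → suc a < suc l) (sym len) (s≤s a<S))

module _ {a ℓ} {X : Set a} (K R₁ R₂ : Rel X ℓ) (R₁? : Decidable R₁) (R₂? : Decidable R₂)
  (R₁-trans : ∀ {x y z} → K x y → K y z → K x z → R₁ x y → R₁ y z → R₁ x z)
  (R₂-trans : ∀ {x y z} → K x y → K y z → K x z → R₂ x y → R₂ y z → R₂ x z) where

  private
    module First = ChainOrAntichain K R₁ R₁? R₁-trans
    module Second = ChainOrAntichain (K ∖ R₁) R₂ R₂? (λ (Kxy , _) (Kyz , _) (Kxz , _) → R₂-trans Kxy Kyz Kxz)

  chain-or-chain-or-antichain : ∀ a b c E → AllPairs K E → a * (b * c) < length E →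
    Clique> (K ∩ R₁) a ⊎ Clique> ((K ∖ R₁) ∩ R₂) b ⊎ Clique> ((K ∖ R₁) ∖ R₂) c
  chain-or-chain-or-antichain a b c E KE abc<E with First.chain-or-antichain a (b * c) E KE abc<E
  ... | inj₁ (S , _ , chain , a<S) = inj₁ (S , chain , a<S)
  ... | inj₂ (S , _ , antichain , bc<S) with Second.chain-or-antichain b c S antichain bc<S
  ...   | inj₁ (S′ , _ , chain , b<S′) = inj₂ (inj₁ (S′ , chain , b<S′))
  ...   | inj₂ (S′ , _ , antichain , c<S′) = inj₂ (inj₂ (S′ , antichain , c<S′))

-- Shapes of collectable patterns

-- A block (s , σ) is the word σ^(1+s) (not σ)^(1+s), where true is the letter A of the first
-- edge; a shape lists the blocks of a pattern from the last one to the first one.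
Block : Set
Block = ℕ × Bool

Shape : Set
Shape = List Block

edgeSize : Shape → ℕ
edgeSize [] = 0
edgeSize ((s , _) ∷ D) = suc (s + edgeSize D)

blockWord : ℕ → Bool → List Bool
blockWord s σ = replicate (suc s) σ ++ replicate (suc s) (not σ)

word : Shape → List Bool
word [] = []
word ((s , σ) ∷ D) = word D ++ blockWord s σ

StartsWithA : Shape → Set
StartsWithA [] = ⊥
StartsWithA ((_ , σ) ∷ []) = σ ≡ true
StartsWithA (_ ∷ D@(_ ∷ _)) = StartsWithA D

reverse-replicate : ∀ {A : Set} n (x : A) → reverse (replicate n x) ≡ replicate n x
reverse-replicate zero x = refl
reverse-replicate (suc n) x = begin
  reverse (x ∷ replicate n x)  ≡⟨ unfold-reverse x (replicate n x) ⟩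
  reverse (replicate n x) ++ [ x ] ≡⟨ cong (_++ [ x ]) (reverse-replicate n x) ⟩
  replicate n x ++ [ x ]       ≡⟨ replicate-∷ʳ n ⟩
  x ∷ replicate n x            ∎
  where
  open ≡-Reasoning
  replicate-∷ʳ : ∀ n → replicate n x ++ [ x ] ≡ x ∷ replicate n x
  replicate-∷ʳ zero = refl
  replicate-∷ʳ (suc n) = cong (x ∷_) (replicate-∷ʳ n)

reverse-word : ∀ s σ D →
  reverse (word ((s , σ) ∷ D)) ≡ replicate (suc s) (not σ) ++ replicate (suc s) σ ++ reverse (word D)
reverse-word s σ D = begin
  reverse (word D ++ blockWord s σ)
    ≡⟨ reverse-++ (word D) (blockWord s σ) ⟩
  reverse (blockWord s σ) ++ reverse (word D)
    ≡⟨ cong (_++ reverse (word D)) (reverse-++ (replicate (suc s) σ) _) ⟩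
  (reverse (replicate (suc s) (not σ)) ++ reverse (replicate (suc s) σ)) ++ reverse (word D)
    ≡⟨ cong₂ (λ u v → (u ++ v) ++ reverse (word D)) (reverse-replicate (suc s) (not σ)) (reverse-replicate (suc s) σ) ⟩
  (replicate (suc s) (not σ) ++ replicate (suc s) σ) ++ reverse (word D)
    ≡⟨ ++-assoc (replicate (suc s) (not σ)) _ _ ⟩
  replicate (suc s) (not σ) ++ replicate (suc s) σ ++ reverse (word D) ∎
  where open ≡-Reasoning

runFrom-replicate : ∀ {a b} → a ≢ b → ∀ n xs → runFrom a (replicate n a ++ b ∷ xs) ≡ n
runFrom-replicate {true} {false} _ zero _ = refl
runFrom-replicate {false} {true} _ zero _ = refl
runFrom-replicate {true} {true} a≢b zero _ = contradiction refl a≢b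
runFrom-replicate {false} {false} a≢b zero _ = contradiction refl a≢b
runFrom-replicate {true} a≢b (suc n) xs = cong suc (runFrom-replicate a≢b n xs)
runFrom-replicate {false} a≢b (suc n) xs = cong suc (runFrom-replicate a≢b n xs)

not-≢ : ∀ σ → not σ ≢ σ
not-≢ true ()
not-≢ false ()

maturity-word : ∀ s σ D → maturity (word ((s , σ) ∷ D)) ≡ s ∸ 1
maturity-word s σ D = cong (λ w → firstRun w ∸ 2) (reverse-word s σ D)
  ⟨ trans ⟩ cong (λ n → suc n ∸ 2) (runFrom-replicate (not-≢ σ) s (replicate s σ ++ reverse (word D)))

reverse-word-injective : ∀ D D′ → reverse (word D) ≡ reverse (word D′) → D ≡ D′
reverse-word-injective [] [] _ = refl
reverse-word-injective [] ((s , σ) ∷ D′) eq with () ← trans eq (reverse-word s σ D′)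
reverse-word-injective ((s , σ) ∷ D) [] eq with () ← trans (sym (reverse-word s σ D)) eq
reverse-word-injective ((s , σ) ∷ D) ((s′ , σ′) ∷ D′) eq
  with eq′ ← trans (sym (reverse-word s σ D)) (trans eq (reverse-word s′ σ′ D′))
  with refl ← not-injective (just-injective (cong head eq′))
  with refl ← trans (sym (runFrom-replicate (not-≢ σ) (suc s) (replicate s σ ++ reverse (word D))))
                (trans (cong (runFrom (not σ)) eq′)
                       (runFrom-replicate (not-≢ σ) (suc s′) (replicate s′ σ ++ reverse (word D′))))
  = cong ((s , σ) ∷_) (reverse-word-injective D D′
      (++-cancelˡ (replicate (suc s) σ) _ _ (++-cancelˡ (replicate (suc s) (not σ)) _ _ eq′)))

word-injective : ∀ D D′ → word D ≡ word D′ → D ≡ D′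
word-injective D D′ eq = reverse-word-injective D D′ (cong reverse eq)

countB-++ : ∀ b xs ys → countB b (xs ++ ys) ≡ countB b xs + countB b ys
countB-++ b [] ys = refl
countB-++ true (true ∷ xs) ys = cong suc (countB-++ true xs ys)
countB-++ true (false ∷ xs) ys = countB-++ true xs ys
countB-++ false (false ∷ xs) ys = cong suc (countB-++ false xs ys)
countB-++ false (true ∷ xs) ys = countB-++ false xs ys

countB-replicate-same : ∀ b n → countB b (replicate n b) ≡ n
countB-replicate-same b zero = refl
countB-replicate-same true (suc n) = cong suc (countB-replicate-same true n)
countB-replicate-same false (suc n) = cong suc (countB-replicate-same false n)

countB-replicate-not : ∀ b n → countB b (replicate n (not b)) ≡ 0
countB-replicate-not b zero = refl
countB-replicate-not true (suc n) = countB-replicate-not true n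
countB-replicate-not false (suc n) = countB-replicate-not false n

countB-blockWord : ∀ b s σ → countB b (blockWord s σ) ≡ suc s
countB-blockWord b s σ = trans (countB-++ b (replicate (suc s) σ) _) (count b σ)
  where
  count : ∀ b σ → countB b (replicate (suc s) σ) + countB b (replicate (suc s) (not σ)) ≡ suc s
  count true true = cong₂ _+_ (countB-replicate-same true (suc s)) (countB-replicate-not true (suc s)) ⟨ trans ⟩ +-identityʳ _
  count false false = cong₂ _+_ (countB-replicate-same false (suc s)) (countB-replicate-not false (suc s)) ⟨ trans ⟩ +-identityʳ _
  count true false = cong₂ _+_ (countB-replicate-not true (suc s)) (countB-replicate-same true (suc s))
  count false true = cong₂ _+_ (countB-replicate-not false (suc s)) (countB-replicate-same false (suc s))

countB-word : ∀ b D → countB b (word D) ≡ edgeSize D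
countB-word b [] = refl
countB-word b ((s , σ) ∷ D) = begin
  countB b (word D ++ blockWord s σ)             ≡⟨ countB-++ b (word D) _ ⟩
  countB b (word D) + countB b (blockWord s σ)   ≡⟨ cong₂ _+_ (countB-word b D) (countB-blockWord b s σ) ⟩
  edgeSize D + suc s                             ≡⟨ +-comm (edgeSize D) (suc s) ⟩
  suc (s + edgeSize D)                           ∎
  where open ≡-Reasoning

word-startsWithA : ∀ D → StartsWithA D → ∃ λ w → word D ≡ true ∷ w
word-startsWithA ((s , .true) ∷ []) refl = _ , refl
word-startsWithA ((s , σ) ∷ D@(_ ∷ _)) startsA with _ , eq ← word-startsWithA D startsA =
  _ , cong (_++ blockWord s σ) eq

word-isPattern : ∀ D → StartsWithA D → IsPattern (edgeSize D) (word D)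
word-isPattern D startsA with _ , eq ← word-startsWithA D startsA =
  subst (IsPattern (edgeSize D)) (sym eq)
    (refl , trans (cong (countB true) (sym eq)) (countB-word true D)
          , trans (cong (countB false) (sym eq)) (countB-word false D))

-- The canonical clique of a shape

module _ {A : Set} where

  filter≡filterᵇ : ∀ {P : A → Set} (P? : ∀ x → Dec (P x)) xs → filter P? xs ≡ filterᵇ (λ x → does (P? x)) xs
  filter≡filterᵇ P? [] = refl
  filter≡filterᵇ P? (x ∷ xs) with does (P? x)
  ... | true = cong (x ∷_) (filter≡filterᵇ P? xs)
  ... | false = filter≡filterᵇ P? xs

  filterᵇ-cong : ∀ {p q : A → Bool} → p ≗ q → filterᵇ p ≗ filterᵇ q
  filterᵇ-cong {p} {q} p≗q [] = refl
  filterᵇ-cong {p} {q} p≗q (x ∷ xs) with p x | q x | p≗q x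
  ... | true | true | refl = cong (x ∷_) (filterᵇ-cong p≗q xs)
  ... | false | false | refl = filterᵇ-cong p≗q xs

  filterᵇ-map : ∀ {B : Set} (p : B → Bool) (f : A → B) xs → filterᵇ p (map f xs) ≡ map f (filterᵇ (p ∘ f) xs)
  filterᵇ-map p f [] = refl
  filterᵇ-map p f (x ∷ xs) with p (f x)
  ... | true = cong (f x ∷_) (filterᵇ-map p f xs)
  ... | false = filterᵇ-map p f xs

  filterᵇ-replicate : ∀ (p : A → Bool) n {x b} → p x ≡ b → filterᵇ p (replicate n x) ≡ (if b then replicate n x else [])
  filterᵇ-replicate p zero {b = true} _ = refl
  filterᵇ-replicate p zero {b = false} _ = refl
  filterᵇ-replicate p (suc n) {b = true} px rewrite px = cong (_ ∷_) (filterᵇ-replicate p n px)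
  filterᵇ-replicate p (suc n) {b = false} px rewrite px = filterᵇ-replicate p n px

  filterᵇ-reverse : ∀ (p : A → Bool) xs → filterᵇ p (reverse xs) ≡ reverse (filterᵇ p xs)
  filterᵇ-reverse p [] = refl
  filterᵇ-reverse p (x ∷ xs) = begin
    filterᵇ p (reverse (x ∷ xs))                ≡⟨ cong (filterᵇ p) (unfold-reverse x xs) ⟩
    filterᵇ p (reverse xs ++ [ x ])             ≡⟨ filter-++ (T? ∘ p) (reverse xs) [ x ] ⟩
    filterᵇ p (reverse xs) ++ filterᵇ p [ x ]   ≡⟨ cong (_++ filterᵇ p [ x ]) (filterᵇ-reverse p xs) ⟩
    reverse (filterᵇ p xs) ++ filterᵇ p [ x ]   ≡⟨ last (p x) refl ⟩
    reverse (filterᵇ p (x ∷ xs))                ∎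
    where
    open ≡-Reasoning
    last : ∀ b → p x ≡ b → reverse (filterᵇ p xs) ++ filterᵇ p [ x ] ≡ reverse (filterᵇ p (x ∷ xs))
    last true px rewrite px = sym (unfold-reverse x (filterᵇ p xs))
    last false px rewrite px = ++-identityʳ _

  filterᵇ-concatMap-replicate : ∀ (p : A → Bool) n xs →
    filterᵇ p (concatMap (replicate n) xs) ≡ concatMap (replicate n) (filterᵇ p xs)
  filterᵇ-concatMap-replicate p n [] = refl
  filterᵇ-concatMap-replicate p n (x ∷ xs) with p x in px
  ... | true = trans (filter-++ (T? ∘ p) (replicate n x) _)
                 (cong₂ _++_ (filterᵇ-replicate p n px) (filterᵇ-concatMap-replicate p n xs))
  ... | false = trans (filter-++ (T? ∘ p) (replicate n x) _)
                  (cong₂ _++_ (filterᵇ-replicate p n px) (filterᵇ-concatMap-replicate p n xs))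

  filterᵇ-filterᵇ : ∀ (p q : A → Bool) xs → filterᵇ p (filterᵇ q xs) ≡ filterᵇ (λ x → q x ∧ p x) xs
  filterᵇ-filterᵇ p q [] = refl
  filterᵇ-filterᵇ p q (x ∷ xs) with q x
  ... | false = filterᵇ-filterᵇ p q xs
  ... | true with p x
  ...   | true = cong (x ∷_) (filterᵇ-filterᵇ p q xs)
  ...   | false = filterᵇ-filterᵇ p q xs

pairWord-does : ∀ {N k} (M : Fin N → Fin k) e f →
  pairWord M e f ≡ map (λ i → does (M i ≟ e)) (filterᵇ (λ i → does (M i ≟ e) ∨ does (M i ≟ f)) (allFin N))
pairWord-does {N} M e f = trans (map-cong (λ i → isYes≗does (M i ≟ e)) _)
  (cong (map _) (filterᵇ-cong (λ i → cong₂ _∨_ (isYes≗does (M i ≟ e)) (isYes≗does (M i ≟ f))) (allFin N)))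

allFin-suc : ∀ k → allFin (suc k) ≡ fzero ∷ map fsuc (allFin k)
allFin-suc k = cong (fzero ∷_) (sym (map-tabulate id fsuc))

filterᵇ-allFin-≟ : ∀ k (e : Fin k) → filterᵇ (λ y → does (y ≟ e)) (allFin k) ≡ [ e ]
filterᵇ-allFin-≟ (suc k) e = begin
  filterᵇ p (allFin (suc k))                          ≡⟨ cong (filterᵇ p) (allFin-suc k) ⟩
  filterᵇ p (fzero ∷ map fsuc (allFin k))             ≡⟨ step e ⟩
  [ e ]                                               ∎
  where
  open ≡-Reasoning
  p : Fin (suc k) → Bool
  p y = does (y ≟ e)
  step : ∀ (e : Fin (suc k)) → filterᵇ (λ y → does (y ≟ e)) (fzero ∷ map fsuc (allFin k)) ≡ [ e ]
  step fzero = cong (fzero ∷_) (trans (filterᵇ-map _ fsuc (allFin k))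
                 (cong (map fsuc) (filter-none (T? ∘ λ _ → false) (All.universal (λ _ ()) (allFin k)))))
  step (fsuc e) = trans (filterᵇ-map (λ y → does (y ≟ fsuc e)) fsuc (allFin k)) (cong (map fsuc) (filterᵇ-allFin-≟ k e))

filterᵇ-allFin-≟-pair : ∀ k {e f : Fin k} → e Fin.< f →
  filterᵇ (λ y → does (y ≟ e) ∨ does (y ≟ f)) (allFin k) ≡ e ∷ f ∷ []
filterᵇ-allFin-≟-pair (suc k) {e} {f} e<f = trans (cong (filterᵇ p) (allFin-suc k)) (step e<f)
  where
  p : Fin (suc k) → Bool
  p y = does (y ≟ e) ∨ does (y ≟ f)
  step : ∀ {e f : Fin (suc k)} → e Fin.< f →
    filterᵇ (λ y → does (y ≟ e) ∨ does (y ≟ f)) (fzero ∷ map fsuc (allFin k)) ≡ e ∷ f ∷ []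
  step {fzero} {fsuc f} _ = cong (fzero ∷_) (trans (filterᵇ-map (λ y → does (y ≟ fzero) ∨ does (y ≟ fsuc f)) fsuc (allFin k))
                              (cong (map fsuc) (filterᵇ-allFin-≟ k f)))
  step {fsuc e} {fsuc f} (s≤s e<f) = trans (filterᵇ-map (λ y → does (y ≟ fsuc e) ∨ does (y ≟ fsuc f)) fsuc (allFin k))
                                       (cong (map fsuc) (filterᵇ-allFin-≟-pair k e<f))

ordered : ∀ {A : Set} → Bool → List A → List A
ordered true xs = xs
ordered false xs = reverse xs

filterᵇ-ordered : ∀ {A : Set} (p : A → Bool) σ xs → filterᵇ p (ordered σ xs) ≡ ordered σ (filterᵇ p xs)
filterᵇ-ordered p true xs = refl
filterᵇ-ordered p false xs = filterᵇ-reverse p xs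

length-ordered : ∀ {A : Set} σ (xs : List A) → length (ordered σ xs) ≡ length xs
length-ordered true xs = refl
length-ordered false xs = length-reverse xs

length-concatMap-replicate : ∀ {A : Set} n (xs : List A) → length (concatMap (replicate n) xs) ≡ n * length xs
length-concatMap-replicate n [] = sym (*-zeroʳ n)
length-concatMap-replicate n (x ∷ xs) = begin
  length (replicate n x ++ concatMap (replicate n) xs)      ≡⟨ length-++ (replicate n x) ⟩
  length (replicate n x) + length (concatMap (replicate n) xs) ≡⟨ cong₂ _+_ (length-replicate n) (length-concatMap-replicate n xs) ⟩
  n + n * length xs                                         ≡⟨ *-suc n (length xs) ⟨
  n * suc (length xs)                                       ∎
  where open ≡-Reasoning

-- Vertex labels of the canonical clique: in a block (s , σ) every edge owns 1+s consecutive
-- vertices, the edges coming in increasing order if σ = true and in decreasing order otherwise.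
blockLabels : ℕ → Bool → (k : ℕ) → List (Fin k)
blockLabels s σ k = concatMap (replicate (suc s)) (ordered σ (allFin k))

shapeLabels : Shape → (k : ℕ) → List (Fin k)
shapeLabels [] k = []
shapeLabels ((s , σ) ∷ D) k = shapeLabels D k ++ blockLabels s σ k

length-shapeLabels : ∀ D k → length (shapeLabels D k) ≡ edgeSize D * k
length-shapeLabels [] k = refl
length-shapeLabels ((s , σ) ∷ D) k = begin
  length (shapeLabels D k ++ blockLabels s σ k)            ≡⟨ length-++ (shapeLabels D k) ⟩
  length (shapeLabels D k) + length (blockLabels s σ k)    ≡⟨ cong₂ _+_ (length-shapeLabels D k) length-block ⟩
  edgeSize D * k + suc s * k                               ≡⟨ *-distribʳ-+ k (edgeSize D) (suc s) ⟨
  (edgeSize D + suc s) * k                                 ≡⟨ cong (_* k) (+-comm (edgeSize D) (suc s)) ⟩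
  suc (s + edgeSize D) * k                                 ∎
  where
  open ≡-Reasoning
  length-block : length (blockLabels s σ k) ≡ suc s * k
  length-block = trans (length-concatMap-replicate (suc s) (ordered σ (allFin k)))
                   (cong (suc s *_) (trans (length-ordered σ (allFin k)) (length-tabulate id)))

filterᵇ-blockLabels : ∀ {k} (p : Fin k → Bool) s σ →
  filterᵇ p (blockLabels s σ k) ≡ concatMap (replicate (suc s)) (ordered σ (filterᵇ p (allFin k)))
filterᵇ-blockLabels {k} p s σ =
  trans (filterᵇ-concatMap-replicate p (suc s) (ordered σ (allFin k)))
        (cong (concatMap (replicate (suc s))) (filterᵇ-ordered p σ (allFin k)))

count-blockLabels : ∀ {k} (e : Fin k) s σ → length (filterᵇ (λ y → does (y ≟ e)) (blockLabels s σ k)) ≡ suc s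
count-blockLabels {k} e s σ = begin
  length (filterᵇ p (blockLabels s σ k))                              ≡⟨ cong length (filterᵇ-blockLabels p s σ) ⟩
  length (concatMap (replicate (suc s)) (ordered σ (filterᵇ p (allFin k))))
    ≡⟨ cong (λ ys → length (concatMap (replicate (suc s)) (ordered σ ys))) (filterᵇ-allFin-≟ k e) ⟩
  length (concatMap (replicate (suc s)) (ordered σ [ e ]))            ≡⟨ length-concatMap-replicate (suc s) (ordered σ [ e ]) ⟩
  suc s * length (ordered σ [ e ])                                    ≡⟨ cong (suc s *_) (length-ordered σ [ e ]) ⟩
  suc s * 1                                                           ≡⟨ *-identityʳ (suc s) ⟩
  suc s                                                               ∎
  where
  open ≡-Reasoning
  p : Fin k → Bool
  p y = does (y ≟ e)

count-shapeLabels : ∀ {k} (e : Fin k) D → length (filterᵇ (λ y → does (y ≟ e)) (shapeLabels D k)) ≡ edgeSize D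
count-shapeLabels e [] = refl
count-shapeLabels {k} e ((s , σ) ∷ D) = begin
  length (filterᵇ p (shapeLabels D k ++ blockLabels s σ k))
    ≡⟨ cong length (filter-++ (T? ∘ p) (shapeLabels D k) _) ⟩
  length (filterᵇ p (shapeLabels D k) ++ filterᵇ p (blockLabels s σ k))
    ≡⟨ length-++ (filterᵇ p (shapeLabels D k)) ⟩
  length (filterᵇ p (shapeLabels D k)) + length (filterᵇ p (blockLabels s σ k))
    ≡⟨ cong₂ _+_ (count-shapeLabels e D) (count-blockLabels e s σ) ⟩
  edgeSize D + suc s
    ≡⟨ +-comm (edgeSize D) (suc s) ⟩
  suc (s + edgeSize D) ∎
  where
  open ≡-Reasoning
  p : Fin k → Bool
  p y = does (y ≟ e)

map-concatMap-replicate : ∀ {A B : Set} (g : A → B) n xs →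
  map g (concatMap (replicate n) xs) ≡ concatMap (replicate n) (map g xs)
map-concatMap-replicate g n [] = refl
map-concatMap-replicate g n (x ∷ xs) =
  trans (map-++ g (replicate n x) _) (cong₂ _++_ (map-replicate g n x) (map-concatMap-replicate g n xs))

module _ {k} {e f : Fin k} (e<f : e Fin.< f) where

  private
    g h : Fin k → Bool
    g y = does (y ≟ e)
    h y = does (y ≟ e) ∨ does (y ≟ f)

  word-blockLabels : ∀ s σ → map g (filterᵇ h (blockLabels s σ k)) ≡ blockWord s σ
  word-blockLabels s σ = begin
    map g (filterᵇ h (blockLabels s σ k))                               ≡⟨ cong (map g) (filterᵇ-blockLabels h s σ) ⟩
    map g (concatMap (replicate (suc s)) (ordered σ (filterᵇ h (allFin k))))
      ≡⟨ cong (λ ys → map g (concatMap (replicate (suc s)) (ordered σ ys))) (filterᵇ-allFin-≟-pair k e<f) ⟩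
    map g (concatMap (replicate (suc s)) (ordered σ (e ∷ f ∷ [])))
      ≡⟨ map-concatMap-replicate g (suc s) (ordered σ (e ∷ f ∷ [])) ⟩
    concatMap (replicate (suc s)) (map g (ordered σ (e ∷ f ∷ [])))      ≡⟨ block σ ⟩
    blockWord s σ                                                       ∎
    where
    open ≡-Reasoning
    ge : g e ≡ true
    ge = dec-true (e ≟ e) refl
    gf : g f ≡ false
    gf = dec-false (f ≟ e) (<⇒≢ e<f ∘ sym)
    block : ∀ σ → concatMap (replicate (suc s)) (map g (ordered σ (e ∷ f ∷ []))) ≡ blockWord s σ
    block true rewrite ge | gf = cong (replicate (suc s) true ++_) (++-identityʳ _)
    block false rewrite ge | gf = cong (replicate (suc s) false ++_) (++-identityʳ _)

  word-shapeLabels : ∀ D → map g (filterᵇ h (shapeLabels D k)) ≡ word D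
  word-shapeLabels [] = refl
  word-shapeLabels ((s , σ) ∷ D) = begin
    map g (filterᵇ h (shapeLabels D k ++ blockLabels s σ k))
      ≡⟨ cong (map g) (filter-++ (T? ∘ h) (shapeLabels D k) _) ⟩
    map g (filterᵇ h (shapeLabels D k) ++ filterᵇ h (blockLabels s σ k))
      ≡⟨ map-++ g (filterᵇ h (shapeLabels D k)) _ ⟩
    map g (filterᵇ h (shapeLabels D k)) ++ map g (filterᵇ h (blockLabels s σ k))
      ≡⟨ cong₂ _++_ (word-shapeLabels D) (word-blockLabels s σ) ⟩
    word D ++ blockWord s σ ∎
    where open ≡-Reasoning

module _ {N k} {M : Fin N → Fin k} {L} (labels : map M (allFin N) ≡ L) where

  count-labels : ∀ e → length (filter (λ i → M i ≟ e) (allFin N)) ≡ length (filterᵇ (λ y → does (y ≟ e)) L)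
  count-labels e = begin
    length (filter (λ i → M i ≟ e) (allFin N))     ≡⟨ cong length (filter≡filterᵇ (λ i → M i ≟ e) (allFin N)) ⟩
    length (filterᵇ (p ∘ M) (allFin N))            ≡⟨ length-map M (filterᵇ (p ∘ M) (allFin N)) ⟨
    length (map M (filterᵇ (p ∘ M) (allFin N)))    ≡⟨ cong length (filterᵇ-map p M (allFin N)) ⟨
    length (filterᵇ p (map M (allFin N)))          ≡⟨ cong (length ∘ filterᵇ p) labels ⟩
    length (filterᵇ p L)                           ∎
    where
    open ≡-Reasoning
    p : Fin k → Bool
    p y = does (y ≟ e)

  pairWord-labels : ∀ e f →
    pairWord M e f ≡ map (λ y → does (y ≟ e)) (filterᵇ (λ y → does (y ≟ e) ∨ does (y ≟ f)) L)
  pairWord-labels e f = begin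
    pairWord M e f                                ≡⟨ pairWord-does M e f ⟩
    map (g ∘ M) (filterᵇ (h ∘ M) (allFin N))      ≡⟨ map-∘ _ ⟩
    map g (map M (filterᵇ (h ∘ M) (allFin N)))    ≡⟨ cong (map g) (filterᵇ-map h M (allFin N)) ⟨
    map g (filterᵇ h (map M (allFin N)))          ≡⟨ cong (map g ∘ filterᵇ h) labels ⟩
    map g (filterᵇ h L)                           ∎
    where
    open ≡-Reasoning
    g h : Fin k → Bool
    g y = does (y ≟ e)
    h y = does (y ≟ e) ∨ does (y ≟ f)

map-lookup-cast : ∀ {A : Set} (L : List A) {N} (eq : N ≡ length L) → map (lookup L ∘ cast eq) (allFin N) ≡ L
map-lookup-cast L refl = begin
  map (lookup L ∘ cast refl) (allFin (length L))  ≡⟨ map-cong (cong (lookup L) ∘ cast-is-id refl) (allFin (length L)) ⟩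
  map (lookup L) (tabulate id)                    ≡⟨ map-tabulate id (lookup L) ⟩
  tabulate (lookup L)                             ≡⟨ tabulate-lookup L ⟩
  L                                               ∎
  where open ≡-Reasoning

canonicalMatching : (D : Shape) (k : ℕ) → Fin (edgeSize D * k) → Fin k
canonicalMatching D k = lookup (shapeLabels D k) ∘ cast (sym (length-shapeLabels D k))

word-collectable : ∀ D → Collectable (edgeSize D) (word D)
word-collectable D k _ = canonicalMatching D k , isMatching , forms
  where
  labels : map (canonicalMatching D k) (allFin (edgeSize D * k)) ≡ shapeLabels D k
  labels = map-lookup-cast (shapeLabels D k) (sym (length-shapeLabels D k))
  isMatching : IsMatching (edgeSize D) k (canonicalMatching D k)
  isMatching e = trans (count-labels labels e) (count-shapeLabels e D)
  forms : ∀ e f → e ≢ f → Forms (canonicalMatching D k) e f (word D)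
  forms e f e≢f with <-cmp e f
  ... | tri< e<f _ _ = inj₁ (trans (pairWord-labels labels e f) (word-shapeLabels e<f D))
  ... | tri≈ _ e≡f _ = contradiction e≡f e≢f
  ... | tri> _ _ f<e = inj₂ (trans (pairWord-labels labels f e) (word-shapeLabels f<e D))

-- The tree of shapes

module _ {m : ℕ} where

  branch₀ branch₁ branch₂ : Fin m → Fin (3 * m)
  branch₀ i = i ↑ˡ (m + (m + 0))
  branch₁ i = m ↑ʳ (i ↑ˡ (m + 0))
  branch₂ i = m ↑ʳ (m ↑ʳ (i ↑ˡ 0))

  select : ∀ {A : Set} → Fin (3 * m) → (Fin m → A) → (Fin m → A) → (Fin m → A) → A
  select ℓ f g h with splitAt m ℓ
  ... | inj₁ i = f i
  ... | inj₂ ℓ′ with splitAt m ℓ′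
  ... | inj₁ i = g i
  ... | inj₂ ℓ″ with splitAt m ℓ″
  ... | inj₁ i = h i

  select-branch₀ : ∀ {A : Set} i (f g h : Fin m → A) → select (branch₀ i) f g h ≡ f i
  select-branch₀ i f g h rewrite splitAt-↑ˡ m i (m + (m + 0)) = refl

  select-branch₁ : ∀ {A : Set} i (f g h : Fin m → A) → select (branch₁ i) f g h ≡ g i
  select-branch₁ i f g h rewrite splitAt-↑ʳ m (m + (m + 0)) (i ↑ˡ (m + 0)) | splitAt-↑ˡ m i (m + 0) = refl

  select-branch₂ : ∀ {A : Set} i (f g h : Fin m → A) → select (branch₂ i) f g h ≡ h i
  select-branch₂ i f g h
    rewrite splitAt-↑ʳ m (m + (m + 0)) (m ↑ʳ (i ↑ˡ 0)) | splitAt-↑ʳ m (m + 0) (i ↑ˡ 0) | splitAt-↑ˡ m i 0 = refl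

  select-elim : ∀ {A : Set} (P : A → Set) ℓ {f g h : Fin m → A} →
    (∀ i → P (f i)) → (∀ i → P (g i)) → (∀ i → P (h i)) → P (select ℓ f g h)
  select-elim P ℓ Pf Pg Ph with splitAt m ℓ
  ... | inj₁ i = Pf i
  ... | inj₂ ℓ′ with splitAt m ℓ′
  ... | inj₁ i = Pg i
  ... | inj₂ ℓ″ with splitAt m ℓ″
  ... | inj₁ i = Ph i

  data BranchView : Fin (3 * m) → Set where
    at₀ : ∀ i → BranchView (branch₀ i)
    at₁ : ∀ i → BranchView (branch₁ i)
    at₂ : ∀ i → BranchView (branch₂ i)

  branchView : ∀ ℓ → BranchView ℓ
  branchView ℓ with splitAt m ℓ in eq
  ... | inj₁ i = subst BranchView (splitAt⁻¹-↑ˡ eq) (at₀ i)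
  ... | inj₂ ℓ′ with splitAt m ℓ′ in eq′
  ... | inj₁ i = subst BranchView (trans (cong (m ↑ʳ_) (splitAt⁻¹-↑ˡ eq′)) (splitAt⁻¹-↑ʳ eq)) (at₁ i)
  ... | inj₂ ℓ″ with splitAt m ℓ″ in eq″
  ... | inj₁ i = subst BranchView
                   (trans (cong (λ x → m ↑ʳ (m ↑ʳ x)) (splitAt⁻¹-↑ˡ eq″))
                     (trans (cong (m ↑ʳ_) (splitAt⁻¹-↑ʳ eq′)) (splitAt⁻¹-↑ʳ eq))) (at₂ i)

-- The 3^j shapes reached from (s , σ) ∷ D by giving every edge j more vertices; the three branches
-- lengthen the last block, or open a block of the same or of the opposite orientation.
leafShape : (j s : ℕ) (σ : Bool) (D : Shape) → Fin (3 ^ j) → Shape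
leafShape zero s σ D _ = (s , σ) ∷ D
leafShape (suc j) s σ D ℓ =
  select ℓ (leafShape j (suc s) σ D) (leafShape j 0 σ ((s , σ) ∷ D)) (leafShape j 0 (not σ) ((s , σ) ∷ D))

leafShape-edgeSize : ∀ j s σ D ℓ → edgeSize (leafShape j s σ D ℓ) ≡ edgeSize ((s , σ) ∷ D) + j
leafShape-edgeSize zero s σ D ℓ = sym (+-identityʳ _)
leafShape-edgeSize (suc j) s σ D ℓ = select-elim (λ L → edgeSize L ≡ edgeSize ((s , σ) ∷ D) + suc j) ℓ
  (λ i → trans (leafShape-edgeSize j (suc s) σ D i) (sym (+-suc _ j)))
  (λ i → trans (leafShape-edgeSize j 0 σ ((s , σ) ∷ D) i) (sym (+-suc _ j)))
  (λ i → trans (leafShape-edgeSize j 0 (not σ) ((s , σ) ∷ D) i) (sym (+-suc _ j)))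

leafShape-startsWithA : ∀ j s σ D ℓ → StartsWithA ((s , σ) ∷ D) → StartsWithA (leafShape j s σ D ℓ)
leafShape-startsWithA zero s σ D ℓ startsA = startsA
leafShape-startsWithA (suc j) s σ D ℓ startsA = select-elim StartsWithA ℓ
  (λ i → leafShape-startsWithA j (suc s) σ D i (lengthen D startsA))
  (λ i → leafShape-startsWithA j 0 σ ((s , σ) ∷ D) i startsA)
  (λ i → leafShape-startsWithA j 0 (not σ) ((s , σ) ∷ D) i startsA)
  where
  lengthen : ∀ D → StartsWithA ((s , σ) ∷ D) → StartsWithA ((suc s , σ) ∷ D)
  lengthen [] startsA = startsA
  lengthen (_ ∷ _) startsA = startsA

shrink : Shape → Shape
shrink [] = []
shrink ((zero , σ) ∷ D) = D
shrink ((suc s , σ) ∷ D) = (s , σ) ∷ D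

shrinkBy : ℕ → Shape → Shape
shrinkBy zero D = D
shrinkBy (suc j) D = shrink (shrinkBy j D)

shrinkBy-leafShape : ∀ j s σ D ℓ → shrinkBy j (leafShape j s σ D ℓ) ≡ (s , σ) ∷ D
shrinkBy-leafShape zero s σ D ℓ = refl
shrinkBy-leafShape (suc j) s σ D ℓ = select-elim (λ L → shrinkBy (suc j) L ≡ (s , σ) ∷ D) ℓ
  (λ i → cong shrink (shrinkBy-leafShape j (suc s) σ D i))
  (λ i → cong shrink (shrinkBy-leafShape j 0 σ ((s , σ) ∷ D) i))
  (λ i → cong shrink (shrinkBy-leafShape j 0 (not σ) ((s , σ) ∷ D) i))

leafIndex : (j s : ℕ) (σ : Bool) (D : Shape) → Shape → Fin (3 ^ j)
leafIndex zero s σ D L = fzero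
leafIndex (suc j) s σ D L with shrinkBy j L
... | (zero , τ) ∷ _ = if τ xor σ then branch₂ (leafIndex j 0 (not σ) ((s , σ) ∷ D) L)
                                   else branch₁ (leafIndex j 0 σ ((s , σ) ∷ D) L)
... | _ = branch₀ (leafIndex j (suc s) σ D L)

leafIndex-leafShape : ∀ j s σ D ℓ → leafIndex j s σ D (leafShape j s σ D ℓ) ≡ ℓ
leafIndex-leafShape zero s σ D fzero = refl
leafIndex-leafShape (suc j) s σ D ℓ with branchView {3 ^ j} ℓ
... | at₀ i = trans (cong (leafIndex (suc j) s σ D) (select-branch₀ i _ _ _)) index₀
  where
  index₀ : leafIndex (suc j) s σ D (leafShape j (suc s) σ D i) ≡ branch₀ i
  index₀ rewrite shrinkBy-leafShape j (suc s) σ D i = cong branch₀ (leafIndex-leafShape j (suc s) σ D i)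
... | at₁ i = trans (cong (leafIndex (suc j) s σ D) (select-branch₁ i _ _ _)) index₁
  where
  index₁ : leafIndex (suc j) s σ D (leafShape j 0 σ ((s , σ) ∷ D) i) ≡ branch₁ i
  index₁ rewrite shrinkBy-leafShape j 0 σ ((s , σ) ∷ D) i | xor-same σ =
    cong branch₁ (leafIndex-leafShape j 0 σ ((s , σ) ∷ D) i)
... | at₂ i = trans (cong (leafIndex (suc j) s σ D) (select-branch₂ i _ _ _)) index₂
  where
  not-xor : ∀ σ → not σ xor σ ≡ true
  not-xor true = refl
  not-xor false = refl
  index₂ : leafIndex (suc j) s σ D (leafShape j 0 (not σ) ((s , σ) ∷ D) i) ≡ branch₂ i
  index₂ rewrite shrinkBy-leafShape j 0 (not σ) ((s , σ) ∷ D) i | not-xor σ =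
    cong branch₂ (leafIndex-leafShape j 0 (not σ) ((s , σ) ∷ D) i)

leafShape-injective : ∀ j s σ D {ℓ ℓ′} → leafShape j s σ D ℓ ≡ leafShape j s σ D ℓ′ → ℓ ≡ ℓ′
leafShape-injective j s σ D {ℓ} {ℓ′} eq =
  trans (sym (leafIndex-leafShape j s σ D ℓ)) (trans (cong (leafIndex j s σ D) eq) (leafIndex-leafShape j s σ D ℓ′))

∏-split : ∀ m n (f : Fin (m + n) → ℕ) → ∏ f ≡ ∏ {m} (f ∘ (_↑ˡ n)) * ∏ {n} (f ∘ (m ↑ʳ_))
∏-split zero n f = sym (+-identityʳ (∏ f))
∏-split (suc m) n f = trans (cong (f fzero *_) (∏-split m n (f ∘ fsuc))) (sym (*-assoc (f fzero) _ _))

∏-select : ∀ m {A : Set} (F : Fin (3 * m) → A → ℕ) (T₀ T₁ T₂ : Fin m → A) →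
  ∏ (λ ℓ → F ℓ (select ℓ T₀ T₁ T₂)) ≡
  ∏ (λ i → F (branch₀ i) (T₀ i)) * (∏ (λ i → F (branch₁ i) (T₁ i)) * (∏ (λ i → F (branch₂ i) (T₂ i)) * 1))
∏-select m F T₀ T₁ T₂ =
  trans (∏-split m (m + (m + 0)) G) (cong₂ _*_ (∏-cong (λ i → cong (F (branch₀ i)) (select-branch₀ i T₀ T₁ T₂)))
  (trans (∏-split m (m + 0) (G ∘ (m ↑ʳ_))) (cong₂ _*_ (∏-cong (λ i → cong (F (branch₁ i)) (select-branch₁ i T₀ T₁ T₂)))
  (trans (∏-split m 0 (G ∘ (m ↑ʳ_) ∘ (m ↑ʳ_)))
         (cong (_* 1) (∏-cong (λ i → cong (F (branch₂ i)) (select-branch₂ i T₀ T₁ T₂))))))))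
  where
  G : Fin (3 * m) → ℕ
  G ℓ = F ℓ (select ℓ T₀ T₁ T₂)

-- Opening a block of the same orientation after a block of length at least 2 costs a factor 2.
factor : ℕ → ℕ
factor zero = 1
factor (suc _) = 2

-- The clique size needed at (s , σ) ∷ D for a clique larger than c ℓ at some leaf ℓ below it.
bound : (j s : ℕ) (σ : Bool) (D : Shape) → (Fin (3 ^ j) → ℕ) → ℕ
bound zero s σ D c = c fzero
bound (suc j) s σ D c =
  bound j 0 (not σ) ((s , σ) ∷ D) (c ∘ branch₂) *
  (bound j (suc s) σ D (c ∘ branch₀) * (factor s * bound j 0 σ ((s , σ) ∷ D) (c ∘ branch₁)))

bound-product : ∀ j s σ D c →
  bound j s σ D c * 2 ^ (s ∸ 1) ≡ ∏ (λ ℓ → c ℓ * 2 ^ maturity (word (leafShape j s σ D ℓ)))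
bound-product zero s σ D c =
  sym (trans (*-identityʳ _) (cong (λ m → c fzero * 2 ^ m) (maturity-word s σ D)))
bound-product (suc j) s σ D c = begin
  B₂ * (B₀ * (factor s * B₁)) * 2 ^ (s ∸ 1)
    ≡⟨ regroup B₀ B₁ B₂ (factor s) (2 ^ (s ∸ 1)) ⟩
  B₀ * (factor s * 2 ^ (s ∸ 1)) * (B₁ * 1 * (B₂ * 1 * 1))
    ≡⟨ cong (λ x → B₀ * x * (B₁ * 1 * (B₂ * 1 * 1))) (factor-pow s) ⟩
  B₀ * 2 ^ s * (B₁ * 1 * (B₂ * 1 * 1))
    ≡⟨ cong₂ _*_ (bound-product j (suc s) σ D (c ∘ branch₀))
         (cong₂ _*_ (bound-product j 0 σ Q (c ∘ branch₁)) (cong (_* 1) (bound-product j 0 (not σ) Q (c ∘ branch₂)))) ⟩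
  ∏ (λ i → F (branch₀ i) (T₀ i)) * (∏ (λ i → F (branch₁ i) (T₁ i)) * (∏ (λ i → F (branch₂ i) (T₂ i)) * 1))
    ≡⟨ ∏-select (3 ^ j) F T₀ T₁ T₂ ⟨
  ∏ (λ ℓ → F ℓ (leafShape (suc j) s σ D ℓ)) ∎
  where
  open ≡-Reasoning
  open +-*-Solver
  Q : Shape
  Q = (s , σ) ∷ D
  B₀ B₁ B₂ : ℕ
  B₀ = bound j (suc s) σ D (c ∘ branch₀)
  B₁ = bound j 0 σ Q (c ∘ branch₁)
  B₂ = bound j 0 (not σ) Q (c ∘ branch₂)
  T₀ T₁ T₂ : Fin (3 ^ j) → Shape
  T₀ = leafShape j (suc s) σ D
  T₁ = leafShape j 0 σ Q
  T₂ = leafShape j 0 (not σ) Q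
  F : Fin (3 ^ suc j) → Shape → ℕ
  F ℓ L = c ℓ * 2 ^ maturity (word L)
  regroup : ∀ b₀ b₁ b₂ u x → b₂ * (b₀ * (u * b₁)) * x ≡ b₀ * (u * x) * (b₁ * 1 * (b₂ * 1 * 1))
  regroup = solve 5 (λ b₀ b₁ b₂ u x →
    b₂ :* (b₀ :* (u :* b₁)) :* x := b₀ :* (u :* x) :* (b₁ :* con 1 :* (b₂ :* con 1 :* con 1))) refl
  factor-pow : ∀ s → factor s * 2 ^ (s ∸ 1) ≡ 2 ^ s
  factor-pow zero = refl
  factor-pow (suc s) = refl

-- Words of two sets of positions

-- The word of two disjoint sets of positions given as increasing lists, with A for the first set.
mergeWord : List ℕ → List ℕ → List Bool
mergeWord [] ys = replicate (length ys) false
mergeWord (x ∷ xs) [] = replicate (suc (length xs)) true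
mergeWord (x ∷ xs) (y ∷ ys) = if x <ᵇ y then true ∷ mergeWord xs (y ∷ ys) else false ∷ mergeWord (x ∷ xs) ys

Precedes : List ℕ → List ℕ → Set
Precedes xs ys = All (λ x → All (x <_) ys) xs

mergeWord-[] : ∀ xs → mergeWord xs [] ≡ replicate (length xs) true
mergeWord-[] [] = refl
mergeWord-[] (x ∷ xs) = refl

<ᵇ-true : ∀ {x y} → x < y → (x <ᵇ y) ≡ true
<ᵇ-true {x} {y} x<y with x <ᵇ y | <⇒<ᵇ x<y
... | true | _ = refl

<ᵇ-false : ∀ {x y} → y < x → (x <ᵇ y) ≡ false
<ᵇ-false {x} {y} y<x with x <ᵇ y in eq
... | false = refl
... | true = contradiction (<ᵇ⇒< x y (subst T (sym eq) tt)) (<-asym y<x)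

mergeWord-∷ˡ : ∀ x xs ys → All (x <_) ys → mergeWord (x ∷ xs) ys ≡ true ∷ mergeWord xs ys
mergeWord-∷ˡ x xs [] _ = cong (true ∷_) (sym (mergeWord-[] xs))
mergeWord-∷ˡ x xs (y ∷ ys) (x<y ∷ _) rewrite <ᵇ-true x<y = refl

mergeWord-∷ʳ : ∀ y xs ys → All (y <_) xs → mergeWord xs (y ∷ ys) ≡ false ∷ mergeWord xs ys
mergeWord-∷ʳ y [] ys _ = refl
mergeWord-∷ʳ y (x ∷ xs) ys (y<x ∷ _) rewrite <ᵇ-false y<x = refl

mergeWord-++ : ∀ xs xs′ ys ys′ → Precedes xs ys′ → Precedes ys xs′ →
  mergeWord (xs ++ xs′) (ys ++ ys′) ≡ mergeWord xs ys ++ mergeWord xs′ ys′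
mergeWord-++ [] xs′ [] ys′ _ _ = refl
mergeWord-++ (x ∷ xs) xs′ [] ys′ (x<ys′ ∷ xs<ys′) ys<xs′ =
  trans (mergeWord-∷ˡ x (xs ++ xs′) ys′ x<ys′)
        (cong (true ∷_) (trans (mergeWord-++ xs xs′ [] ys′ xs<ys′ ys<xs′)
                               (cong (_++ mergeWord xs′ ys′) (mergeWord-[] xs))))
mergeWord-++ [] xs′ (y ∷ ys) ys′ xs<ys′ (y<xs′ ∷ ys<xs′) =
  trans (mergeWord-∷ʳ y xs′ (ys ++ ys′) y<xs′) (cong (false ∷_) (mergeWord-++ [] xs′ ys ys′ xs<ys′ ys<xs′))
mergeWord-++ (x ∷ xs) xs′ (y ∷ ys) ys′ (x<ys′ ∷ xs<ys′) (y<xs′ ∷ ys<xs′) =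
  if-++ (x <ᵇ y) (mergeWord-++ xs xs′ (y ∷ ys) ys′ xs<ys′ (y<xs′ ∷ ys<xs′))
                 (mergeWord-++ (x ∷ xs) xs′ ys ys′ (x<ys′ ∷ xs<ys′) ys<xs′)
  where
  if-++ : ∀ b {u u′ v v′ w} → u ≡ u′ ++ w → v ≡ v′ ++ w →
    (if b then true ∷ u else false ∷ v) ≡ (if b then true ∷ u′ else false ∷ v′) ++ w
  if-++ true u≡ _ = cong (true ∷_) u≡
  if-++ false _ v≡ = cong (false ∷_) v≡

mergeWord-precedes : ∀ xs ys → Precedes xs ys → mergeWord xs ys ≡ replicate (length xs) true ++ replicate (length ys) false
mergeWord-precedes xs ys xs<ys = begin
  mergeWord xs ys                      ≡⟨ cong (λ xs → mergeWord xs ys) (++-identityʳ xs) ⟨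
  mergeWord (xs ++ []) ([] ++ ys)      ≡⟨ mergeWord-++ xs [] [] ys xs<ys [] ⟩
  mergeWord xs [] ++ mergeWord [] ys   ≡⟨ cong (_++ _) (mergeWord-[] xs) ⟩
  replicate (length xs) true ++ replicate (length ys) false ∎
  where open ≡-Reasoning

mergeWord-follows : ∀ xs ys → Precedes ys xs → mergeWord xs ys ≡ replicate (length ys) false ++ replicate (length xs) true
mergeWord-follows xs ys ys<xs = begin
  mergeWord xs ys                      ≡⟨ cong (mergeWord xs) (++-identityʳ ys) ⟨
  mergeWord ([] ++ xs) (ys ++ [])      ≡⟨ mergeWord-++ [] xs ys [] [] ys<xs ⟩
  mergeWord [] ys ++ mergeWord xs []   ≡⟨ cong (_ ++_) (mergeWord-[] xs) ⟩
  replicate (length ys) false ++ replicate (length xs) true ∎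
  where open ≡-Reasoning

mergeWord-partition : ∀ {A : Set} (key : A → ℕ) (p : A → Bool) us → AllPairs (λ u v → key u < key v) us →
  map p us ≡ mergeWord (map key (filterᵇ p us)) (map key (filterᵇ (not ∘ p) us))
mergeWord-partition key p [] _ = refl
mergeWord-partition key p (u ∷ us) (u<us ∷ sorted) with p u
... | true = trans (cong (true ∷_) (mergeWord-partition key p us sorted))
                   (sym (mergeWord-∷ˡ (key u) _ _ (All.map⁺ (All.filter⁺ (T? ∘ not ∘ p) u<us))))
... | false = trans (cong (false ∷_) (mergeWord-partition key p us sorted))
                    (sym (mergeWord-∷ʳ (key u) _ _ (All.map⁺ (All.filter⁺ (T? ∘ p) u<us))))

range : ℕ → ℕ → List ℕ
range a zero = []
range a (suc n) = a ∷ range (suc a) n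

range-++ : ∀ a m n → range a (m + n) ≡ range a m ++ range (a + m) n
range-++ a zero n = cong (λ b → range b n) (sym (+-identityʳ a))
range-++ a (suc m) n = cong (a ∷_) (trans (range-++ (suc a) m n) (cong (λ b → range (suc a) m ++ range b n) (sym (+-suc a m))))

length-range : ∀ a n → length (range a n) ≡ n
length-range a zero = refl
length-range a (suc n) = cong suc (length-range (suc a) n)

All-range : ∀ {P : ℕ → Set} a n → (∀ {i} → a ≤ i → i < a + n → P i) → All P (range a n)
All-range a zero _ = []
All-range a (suc n) P = P ≤-refl (m<m+n a (s≤s z≤n)) ∷
  All-range (suc a) n (λ {i} a<i i<a+n → P (<⇒≤ a<i) (subst (i <_) (sym (+-suc a n)) i<a+n))

Precedes-range : ∀ (g h : ℕ → ℕ) a m b n → (∀ {i j} → a ≤ i → i < a + m → b ≤ j → j < b + n → g i < h j) →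
  Precedes (map g (range a m)) (map h (range b n))
Precedes-range g h a m b n g<h =
  All.map⁺ (All-range a m (λ a≤i i<a+m → All.map⁺ (All-range b n (λ b≤j j<b+n → g<h a≤i i<a+m b≤j j<b+n))))

-- Refining cliques of edges given by their vertex positions

-- pos e 0 < … < pos e (r - 1) are the positions of the vertices of the edge e.
module Positions (r : ℕ) {Edge : Set} (pos : Edge → ℕ → ℕ)
  (pos-< : ∀ e {i} → suc i < r → pos e i < pos e (suc i))
  (pos-injective : ∀ {e f i j} → i < r → j < r → pos e i ≡ pos f j → e ≡ f) where

  pos-mono : ∀ e {i j} → i ≤ j → j < r → pos e i ≤ pos e j
  pos-mono e {j = zero} z≤n _ = ≤-refl
  pos-mono e {i} {suc j} i≤1+j 1+j<r with m≤n⇒m<n∨m≡n i≤1+j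
  ... | inj₂ refl = ≤-refl
  ... | inj₁ (s≤s i≤j) = ≤-trans (pos-mono e i≤j (<⇒≤ 1+j<r)) (<⇒≤ (pos-< e 1+j<r))

  -- The vertices k, …, k + s of the edges e and f form the block (s , σ).
  BlockOrder : Bool → ℕ → ℕ → Edge → Edge → Set
  BlockOrder true k s e f = pos e (s + k) < pos f k
  BlockOrder false k s e f = pos f (s + k) < pos e k

  -- The vertices before k precede the vertices from k on, in both edges.
  Separated : ℕ → Edge → Edge → Set
  Separated zero e f = ⊤
  Separated (suc k) e f = pos e k < pos f (suc k) × pos f k < pos e (suc k)

  -- The first edgeSize D vertices of e and f, in this order, form the word D, e being the A edge.
  Realises : Shape → Edge → Edge → Set
  Realises [] e f = pos e 0 < pos f 0
  Realises ((s , σ) ∷ D) e f = Realises D e f × BlockOrder σ (edgeSize D) s e f × Separated (edgeSize D) e f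

  realises-≢ : ∀ D {e f} → Realises D e f → e ≢ f
  realises-≢ [] e<f refl = <-irrefl refl e<f
  realises-≢ (_ ∷ D) (R , _) = realises-≢ D R

  ≮⇒> : ∀ {e f i j} → i < r → j < r → e ≢ f → ¬ (pos f j < pos e i) → pos e i < pos f j
  ≮⇒> i<r j<r e≢f ≮ = ≤∧≢⇒< (≮⇒≥ ≮) (e≢f ∘ pos-injective i<r j<r)

  vertices : Edge → ℕ → List ℕ
  vertices e n = map (pos e) (range 0 n)

  earlier-precede : ∀ k n {e f} → k + n ≤ r → Separated k e f →
    Precedes (vertices e k) (map (pos f) (range k n)) × Precedes (vertices f k) (map (pos e) (range k n))
  earlier-precede zero n _ _ = [] , []
  earlier-precede (suc k) n k+n≤r (e<f , f<e) = precede e<f , precede f<e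
    where
    precede : ∀ {e f} → pos e k < pos f (suc k) → Precedes (vertices e (suc k)) (map (pos f) (range (suc k) n))
    precede {e} {f} e<f = Precedes-range (pos e) (pos f) 0 (suc k) (suc k) n
      (λ _ i<1+k 1+k≤j j<1+k+n →
         ≤-<-trans (pos-mono e (≤-pred i<1+k) (<-≤-trans (n<1+n k) (≤-trans (m≤m+n (suc k) n) k+n≤r)))
                   (<-≤-trans e<f (pos-mono f 1+k≤j (<-≤-trans j<1+k+n k+n≤r))))

  module _ {s k : ℕ} (1+s+k≤r : suc (s + k) ≤ r) where

    private
      k+1+s≡1+s+k : k + suc s ≡ suc (s + k)
      k+1+s≡1+s+k = trans (+-suc k s) (cong suc (+-comm k s))

      in-block : ∀ {i} → i < k + suc s → i < r
      in-block {i} i<k+1+s = <-≤-trans (subst (i <_) k+1+s≡1+s+k i<k+1+s) 1+s+k≤r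

      ≤-last : ∀ {i} → i < k + suc s → i ≤ s + k
      ≤-last {i} i<k+1+s = ≤-pred (subst (i <_) k+1+s≡1+s+k i<k+1+s)

      length-block : ∀ e → length (map (pos e) (range k (suc s))) ≡ suc s
      length-block e = trans (length-map (pos e) (range k (suc s))) (length-range k (suc s))

    vertices-split : ∀ e → vertices e (suc (s + k)) ≡ vertices e k ++ map (pos e) (range k (suc s))
    vertices-split e = trans (cong (map (pos e) ∘ range 0) (sym k+1+s≡1+s+k))
                             (trans (cong (map (pos e)) (range-++ 0 k (suc s))) (map-++ (pos e) (range 0 k) _))

    block-precedes : ∀ {e f} → pos e (s + k) < pos f k → Precedes (map (pos e) (range k (suc s))) (map (pos f) (range k (suc s)))
    block-precedes {e} {f} e<f = Precedes-range (pos e) (pos f) k (suc s) k (suc s)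
      (λ _ i<k+1+s k≤j j<k+1+s → ≤-<-trans (pos-mono e (≤-last i<k+1+s) 1+s+k≤r)
                                    (<-≤-trans e<f (pos-mono f k≤j (in-block j<k+1+s))))

    block-word : ∀ σ {e f} → BlockOrder σ k s e f →
      mergeWord (map (pos e) (range k (suc s))) (map (pos f) (range k (suc s))) ≡ blockWord s σ
    block-word true {e} {f} e<f = trans (mergeWord-precedes _ _ (block-precedes e<f))
      (cong₂ (λ m n → replicate m true ++ replicate n false) (length-block e) (length-block f))
    block-word false {e} {f} f<e = trans (mergeWord-follows _ _ (block-precedes f<e))
      (cong₂ (λ m n → replicate m false ++ replicate n true) (length-block f) (length-block e))

  realises-word : ∀ D {e f} → edgeSize D ≤ r → Realises D e f →
    mergeWord (vertices e (edgeSize D)) (vertices f (edgeSize D)) ≡ word D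
  realises-word [] _ _ = refl
  realises-word ((s , σ) ∷ D) {e} {f} 1+s+k≤r (R , order , separated) = begin
    mergeWord (vertices e (suc (s + k))) (vertices f (suc (s + k)))
      ≡⟨ cong₂ mergeWord (vertices-split {s} {k} 1+s+k≤r e) (vertices-split {s} {k} 1+s+k≤r f) ⟩
    mergeWord (vertices e k ++ block e) (vertices f k ++ block f)
      ≡⟨ mergeWord-++ _ _ _ _ (proj₁ earlier) (proj₂ earlier) ⟩
    mergeWord (vertices e k) (vertices f k) ++ mergeWord (block e) (block f)
      ≡⟨ cong₂ _++_ (realises-word D k≤r R) (block-word {s} {k} 1+s+k≤r σ order) ⟩
    word D ++ blockWord s σ ∎
    where
    open ≡-Reasoning
    k : ℕ
    k = edgeSize D
    block : Edge → List ℕ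
    block e = map (pos e) (range k (suc s))
    k+1+s≤r : k + suc s ≤ r
    k+1+s≤r = subst (_≤ r) (sym (trans (+-suc k s) (cong suc (+-comm k s)))) 1+s+k≤r
    k≤r : k ≤ r
    k≤r = ≤-trans (m≤m+n k (suc s)) k+1+s≤r
    earlier : Precedes (vertices e k) (block f) × Precedes (vertices f k) (block e)
    earlier = earlier-precede k (suc s) k+1+s≤r separated

  blockOrder? : ∀ σ k s → Decidable (BlockOrder σ k s)
  blockOrder? true k s e f = pos e (s + k) <? pos f k
  blockOrder? false k s e f = pos f (s + k) <? pos e k

  module _ (D : Shape) (s : ℕ) (t<r : suc (s + edgeSize D) < r) where

    private
      k t : ℕ
      k = edgeSize D
      t = suc (s + k)
      s+k<r : s + k < r
      s+k<r = <-trans (n<1+n (s + k)) t<r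
      k≤s+k : k ≤ s + k
      k≤s+k = m≤n+m k s
      k<r : k < r
      k<r = ≤-<-trans k≤s+k s+k<r
      before-t : ∀ e → pos e (s + k) < pos e t
      before-t e = pos-< e t<r
      first-before-t : ∀ e → pos e k < pos e t
      first-before-t e = ≤-<-trans (pos-mono e k≤s+k s+k<r) (before-t e)

    Flips Lengthens : Bool → Edge → Edge → Set
    Flips σ = BlockOrder (not σ) t 0
    Lengthens σ = BlockOrder σ k (suc s)

    opposite-block : ∀ σ {e f} → Realises ((s , σ) ∷ D) e f → Flips σ e f → Realises ((0 , not σ) ∷ (s , σ) ∷ D) e f
    opposite-block true {e} {f} R@(_ , e<f , _) f<e =
      R , f<e , <-trans (<-≤-trans e<f (pos-mono f k≤s+k s+k<r)) (before-t f) , <-trans (before-t f) f<e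
    opposite-block false {e} {f} R@(_ , f<e , _) e<f =
      R , e<f , <-trans (before-t e) e<f , <-trans (<-≤-trans f<e (pos-mono e k≤s+k s+k<r)) (before-t e)

    lengthen-block : ∀ σ {e f} → Realises ((s , σ) ∷ D) e f → Lengthens σ e f → Realises ((suc s , σ) ∷ D) e f
    lengthen-block σ (R , _ , separated) order = R , order , separated

    flips-trans : ∀ σ {x y z} → Flips σ x y → Flips σ y z → Flips σ x z
    flips-trans true x>y y>z = <-trans y>z x>y
    flips-trans false = <-trans

    lengthens-trans : ∀ σ {x y z} → Realises ((s , σ) ∷ D) y z → Lengthens σ x y → Lengthens σ y z → Lengthens σ x z
    lengthens-trans true {y = y} (_ , y<z , _) x<y _ = <-trans (<-≤-trans x<y (pos-mono y k≤s+k s+k<r)) y<z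
    lengthens-trans false {y = y} _ y<x z<y = <-trans z<y (<-trans (first-before-t y) y<x)

    Neither : Bool → Edge → Edge → Set
    Neither σ = (Realises ((s , σ) ∷ D) ∖ Flips σ) ∖ Lengthens σ

    opens-A-block : ∀ {u v} → Realises ((s , true) ∷ D) u v → ¬ Flips true u v → pos v (s + k) < pos u t →
      Realises ((0 , true) ∷ (s , true) ∷ D) u v
    opens-A-block {u} {v} R ≮ v<u = R , u<v , <-trans (before-t u) u<v , v<u
      where
      u<v : pos u t < pos v t
      u<v = ≮⇒> t<r t<r (realises-≢ ((s , true) ∷ D) R) ≮

    opens-B-block : ∀ {u v} → Realises ((s , false) ∷ D) u v → ¬ Flips false u v → pos u (s + k) < pos v t →
      Realises ((0 , false) ∷ (s , false) ∷ D) u v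
    opens-B-block {u} {v} R ≮ u<v = R , v<u , u<v , <-trans (before-t v) v<u
      where
      v<u : pos v t < pos u t
      v<u = ≮⇒> t<r t<r (realises-≢ ((s , false) ∷ D) R ∘ sym) ≮

    -- The last vertex of the block of v is compared with the new vertex of u through a third edge w:
    -- the block of v ends before the block of w starts, and that is before the new vertex of u.
    opens-A-block-before : ∀ {u v w} → Neither true u v → Neither true v w → Neither true u w →
      Realises ((0 , true) ∷ (s , true) ∷ D) u v
    opens-A-block-before ((Ruv , ≮uv) , _) (((_ , v<w , _) , _) , _) ((Ruw , _) , ≮uw) =
      opens-A-block Ruv ≮uv (<-trans v<w (≮⇒> k<r t<r (realises-≢ ((s , true) ∷ D) Ruw ∘ sym) ≮uw))

    opens-B-block-after : ∀ {w u v} → Neither false w u → Neither false w v → Neither false u v →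
      Realises ((0 , false) ∷ (s , false) ∷ D) u v
    opens-B-block-after (((_ , u<w , _) , _) , _) ((Rwv , _) , ≮wv) ((Ruv , ≮uv) , _) =
      opens-B-block Ruv ≮uv (<-trans u<w (≮⇒> k<r t<r (realises-≢ ((s , false) ∷ D) Rwv) ≮wv))

  same-block : ∀ D s σ {b} (t<r : suc (s + edgeSize D) < r) →
    Clique> (Neither D s t<r σ) (factor s * b) → Clique> (Realises ((0 , σ) ∷ (s , σ) ∷ D)) b
  same-block D zero σ {b} t<r (S , C , size) =
    S , AllPairs.map (opens σ) C , subst (_< length S) (+-identityʳ b) size
    where
    k<r : edgeSize D < r
    k<r = <-trans (n<1+n _) t<r
    opens : ∀ σ {u v} → Neither D 0 t<r σ u v → Realises ((0 , σ) ∷ (0 , σ) ∷ D) u v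
    opens true ((R , ≮) , ≮′) = opens-A-block D 0 t<r R ≮ (≮⇒> k<r t<r (realises-≢ ((0 , true) ∷ D) R ∘ sym) ≮′)
    opens false ((R , ≮) , ≮′) = opens-B-block D 0 t<r R ≮ (≮⇒> k<r t<r (realises-≢ ((0 , false) ∷ D) R) ≮′)
  same-block D (suc s) true t<r = Clique>-dropLast (opens-A-block-before D (suc s) t<r) _
  same-block D (suc s) false t<r = Clique>-dropHead (opens-B-block-after D (suc s) t<r) _

  LeafClique : (j s : ℕ) (σ : Bool) (D : Shape) → (Fin (3 ^ j) → ℕ) → Set
  LeafClique j s σ D c = ∃ λ ℓ → Clique> (Realises (leafShape j s σ D ℓ)) (c ℓ)

  module _ {j s : ℕ} {σ : Bool} {D : Shape} {c : Fin (3 ^ suc j) → ℕ} where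

    leafClique-branch₀ : LeafClique j (suc s) σ D (c ∘ branch₀) → LeafClique (suc j) s σ D c
    leafClique-branch₀ (i , clique) = branch₀ i , subst (λ L → Clique> (Realises L) (c (branch₀ i)))
      (sym (select-branch₀ i (leafShape j (suc s) σ D) _ _)) clique

    leafClique-branch₁ : LeafClique j 0 σ ((s , σ) ∷ D) (c ∘ branch₁) → LeafClique (suc j) s σ D c
    leafClique-branch₁ (i , clique) = branch₁ i , subst (λ L → Clique> (Realises L) (c (branch₁ i)))
      (sym (select-branch₁ i (leafShape j (suc s) σ D) (leafShape j 0 σ ((s , σ) ∷ D)) _)) clique

    leafClique-branch₂ : LeafClique j 0 (not σ) ((s , σ) ∷ D) (c ∘ branch₂) → LeafClique (suc j) s σ D c
    leafClique-branch₂ (i , clique) = branch₂ i , subst (λ L → Clique> (Realises L) (c (branch₂ i)))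
      (sym (select-branch₂ i (leafShape j (suc s) σ D) (leafShape j 0 σ ((s , σ) ∷ D))
                              (leafShape j 0 (not σ) ((s , σ) ∷ D)))) clique

  clique⇒leafClique : ∀ j s σ D → edgeSize ((s , σ) ∷ D) + j ≡ r → ∀ c →
    Clique> (Realises ((s , σ) ∷ D)) (bound j s σ D c) → LeafClique j s σ D c
  clique⇒leafClique zero s σ D _ c clique = fzero , clique
  clique⇒leafClique (suc j) s σ D size≡ c (E , E-clique , E-big) =
    descend (chain-or-chain-or-antichain (Realises Q) (Flips D s t<r σ) (Lengthens D s t<r σ)
              (blockOrder? (not σ) t 0) (blockOrder? σ k (suc s))
              (λ _ _ _ → flips-trans D s t<r σ) (λ _ Ryz _ → lengthens-trans D s t<r σ Ryz)
              B₂ B₀ (factor s * B₁) E E-clique E-big)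
    where
    k t : ℕ
    k = edgeSize D
    t = suc (s + k)
    Q : Shape
    Q = (s , σ) ∷ D
    t<r : t < r
    t<r = subst (t <_) size≡ (m<m+n t (s≤s z≤n))
    size≡′ : suc t + j ≡ r
    size≡′ = trans (sym (+-suc t j)) size≡
    B₀ B₁ B₂ : ℕ
    B₀ = bound j (suc s) σ D (c ∘ branch₀ {3 ^ j})
    B₁ = bound j 0 σ Q (c ∘ branch₁ {3 ^ j})
    B₂ = bound j 0 (not σ) Q (c ∘ branch₂ {3 ^ j})
    descend : Clique> (Realises Q ∩ Flips D s t<r σ) B₂ ⊎
              Clique> ((Realises Q ∖ Flips D s t<r σ) ∩ Lengthens D s t<r σ) B₀ ⊎
              Clique> (Neither D s t<r σ) (factor s * B₁) →
              LeafClique (suc j) s σ D c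
    descend (inj₁ (S , C , big)) = leafClique-branch₂ {j} {s} {σ} {D}
      (clique⇒leafClique j 0 (not σ) Q size≡′ (c ∘ branch₂ {3 ^ j})
        (S , AllPairs.map (λ (R , flips) → opposite-block D s t<r σ R flips) C , big))
    descend (inj₂ (inj₁ (S , C , big))) = leafClique-branch₀ {j} {s} {σ} {D}
      (clique⇒leafClique j (suc s) σ D size≡′ (c ∘ branch₀ {3 ^ j})
        (S , AllPairs.map (λ ((R , _) , lengthens) → lengthen-block D s t<r σ R lengthens) C , big))
    descend (inj₂ (inj₂ clique)) = leafClique-branch₁ {j} {s} {σ} {D}
      (clique⇒leafClique j 0 σ Q size≡′ (c ∘ branch₁ {3 ^ j}) (same-block D s σ t<r clique))

-- Matchings

-- The i-th entry of a list of naturals, or 0 out of range.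
nth : List ℕ → ℕ → ℕ
nth [] _ = 0
nth (x ∷ xs) zero = x
nth (x ∷ xs) (suc i) = nth xs i

nth-< : ∀ {xs} i → AllPairs _<_ xs → suc i < length xs → nth xs i < nth xs (suc i)
nth-< {x ∷ y ∷ xs} zero ((x<y ∷ _) ∷ _) _ = x<y
nth-< {x ∷ xs} (suc i) (_ ∷ sorted) (s≤s 1+i<) = nth-< i sorted 1+i<

nth-∈ : ∀ {xs} i → i < length xs → nth xs i ∈ xs
nth-∈ {x ∷ xs} zero _ = here refl
nth-∈ {x ∷ xs} (suc i) (s≤s i<) = there (nth-∈ i i<)

AllFin-sorted : ∀ k → AllPairs (λ u v → toℕ u < toℕ v) (allFin k)
AllFin-sorted k = AllPairs.tabulate⁺-< id

map-nth-range : ∀ xs → map (nth xs) (range 0 (length xs)) ≡ xs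
map-nth-range [] = refl
map-nth-range (x ∷ xs) = cong (x ∷_) (trans (shift 0 (length xs)) (map-nth-range xs))
  where
  shift : ∀ a m → map (nth (x ∷ xs)) (range (suc a) m) ≡ map (nth xs) (range a m)
  shift a zero = refl
  shift a (suc m) = cong (nth xs a ∷_) (shift (suc a) m)

module Matching {r n : ℕ} (M : Fin (r * n) → Fin n) (matching : IsMatching r n M) where

  vertexList : Fin n → List ℕ
  vertexList e = map toℕ (filter (λ v → M v ≟ e) (allFin (r * n)))

  length-vertexList : ∀ e → length (vertexList e) ≡ r
  length-vertexList e = trans (length-map toℕ (filter (λ v → M v ≟ e) (allFin (r * n)))) (matching e)

  vertexList-sorted : ∀ e → AllPairs _<_ (vertexList e)
  vertexList-sorted e = AllPairs.map⁺ (AllPairs.filter⁺ (λ v → M v ≟ e) (AllFin-sorted (r * n)))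

  pos : Fin n → ℕ → ℕ
  pos e = nth (vertexList e)

  pos-< : ∀ e {i} → suc i < r → pos e i < pos e (suc i)
  pos-< e {i} 1+i<r = nth-< i (vertexList-sorted e) (subst (suc i <_) (sym (length-vertexList e)) 1+i<r)

  vertex : ∀ e {i} → i < r → ∃ λ v → M v ≡ e × pos e i ≡ toℕ v
  vertex e {i} i<r with v , v∈ , pos≡ ← ∈-map⁻ toℕ (nth-∈ i (subst (i <_) (sym (length-vertexList e)) i<r)) =
    v , proj₂ (∈-filter⁻ (λ v → M v ≟ e) {xs = allFin (r * n)} v∈) , pos≡

  pos-injective : ∀ {e f i j} → i < r → j < r → pos e i ≡ pos f j → e ≡ f
  pos-injective {e} {f} i<r j<r eq with v , Mv≡e , eq₁ ← vertex e i<r | w , Mw≡f , eq₂ ← vertex f j<r =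
    trans (sym Mv≡e) (trans (cong M (toℕ-injective (trans (sym eq₁) (trans eq eq₂)))) Mw≡f)

  open Positions r pos pos-< pos-injective public

  vertexList≡vertices : ∀ e → vertexList e ≡ vertices e r
  vertexList≡vertices e = trans (sym (map-nth-range (vertexList e))) (cong (map (pos e) ∘ range 0) (length-vertexList e))

  pairWord-mergeWord : ∀ {e f} → e ≢ f → pairWord M e f ≡ mergeWord (vertexList e) (vertexList f)
  pairWord-mergeWord {e} {f} e≢f = begin
    pairWord M e f
      ≡⟨ pairWord-does M e f ⟩
    map is-e U
      ≡⟨ mergeWord-partition toℕ is-e U (AllPairs.filter⁺ (T? ∘ is-e∨f) (AllFin-sorted (r * n))) ⟩
    mergeWord (map toℕ (filterᵇ is-e U)) (map toℕ (filterᵇ (not ∘ is-e) U))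
      ≡⟨ cong₂ (λ xs ys → mergeWord (map toℕ xs) (map toℕ ys))
           (only e (λ v → proj₁ (pointwise v))) (only f (λ v → proj₂ (pointwise v))) ⟩
    mergeWord (vertexList e) (vertexList f) ∎
    where
    open ≡-Reasoning
    is-e is-e∨f : Fin (r * n) → Bool
    is-e v = does (M v ≟ e)
    is-e∨f v = does (M v ≟ e) ∨ does (M v ≟ f)
    U : List (Fin (r * n))
    U = filterᵇ is-e∨f (allFin (r * n))
    pointwise : ∀ v → is-e∨f v ∧ is-e v ≡ does (M v ≟ e) × is-e∨f v ∧ not (is-e v) ≡ does (M v ≟ f)
    pointwise v with M v ≟ e | M v ≟ f
    ... | yes Mv≡e | yes Mv≡f = contradiction (trans (sym Mv≡e) Mv≡f) e≢f
    ... | yes _ | no _ = refl , refl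
    ... | no _ | yes _ = refl , refl
    ... | no _ | no _ = refl , refl
    only : ∀ {p} x → (∀ v → is-e∨f v ∧ p v ≡ does (M v ≟ x)) →
      filterᵇ p U ≡ filter (λ v → M v ≟ x) (allFin (r * n))
    only {p} x eq = trans (filterᵇ-filterᵇ p is-e∨f (allFin (r * n)))
      (trans (filterᵇ-cong eq (allFin (r * n))) (sym (filter≡filterᵇ (λ v → M v ≟ x) (allFin (r * n)))))

  realises-pairWord : ∀ D {e f} → edgeSize D ≡ r → Realises D e f → pairWord M e f ≡ word D
  realises-pairWord D {e} {f} size≡ R = begin
    pairWord M e f                                    ≡⟨ pairWord-mergeWord (realises-≢ D R) ⟩
    mergeWord (vertexList e) (vertexList f)           ≡⟨ cong₂ mergeWord (vertexList≡vertices e) (vertexList≡vertices f) ⟩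
    mergeWord (vertices e r) (vertices f r)           ≡⟨ cong (λ m → mergeWord (vertices e m) (vertices f m)) size≡ ⟨
    mergeWord (vertices e (edgeSize D)) (vertices f (edgeSize D)) ≡⟨ realises-word D (≤-reflexive size≡) R ⟩
    word D                                            ∎
    where open ≡-Reasoning

  firstVertices : List (Fin (r * n))
  firstVertices = filter (λ v → toℕ v ≟ℕ pos (M v) 0) (allFin (r * n))

  edges : List (Fin n)
  edges = map M firstVertices

  edges-sorted : AllPairs (λ e f → pos e 0 < pos f 0) edges
  edges-sorted = AllPairs.map⁺ (AllPairs.map⁻
    (subst (AllPairs _<_) keys (AllPairs.map⁺ (AllPairs.filter⁺ _ (AllFin-sorted (r * n))))))
    where
    keys : map toℕ firstVertices ≡ map ((λ e → pos e 0) ∘ M) firstVertices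
    keys = map-cong-local (all-filter (λ v → toℕ v ≟ℕ pos (M v) 0) (allFin (r * n)))

  ∈-edges : 0 < r → ∀ e → e ∈ edges
  ∈-edges 0<r e with v , Mv≡e , pos≡ ← vertex e 0<r =
    subst (_∈ edges) Mv≡e (∈-map⁺ M (∈-filter⁺ (λ v → toℕ v ≟ℕ pos (M v) 0) (∈-allFin v)
      (trans (sym pos≡) (cong (λ e → pos e 0) (sym Mv≡e)))))

  n≤length-edges : 0 < r → n ≤ length edges
  n≤length-edges 0<r = injective⇒≤ {f = Any.index ∘ ∈-edges 0<r}
    (λ {e} {f} eq → trans (lookup-index (∈-edges 0<r e)) (trans (cong (lookup edges) eq) (sym (lookup-index (∈-edges 0<r f)))))

  matching⇒leafClique : ∀ j → r ≡ suc j → ∀ c →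
    ∏ (λ ℓ → c ℓ * 2 ^ maturity (word (leafShape j 0 true [] ℓ))) < n → LeafClique j 0 true [] c
  matching⇒leafClique j r≡1+j c small = clique⇒leafClique j 0 true [] (sym r≡1+j) c
    (edges , AllPairs.map (λ e<f → e<f , e<f , tt) edges-sorted , <-≤-trans bound<n (n≤length-edges 0<r))
    where
    0<r : 0 < r
    0<r = subst (0 <_) (sym r≡1+j) (s≤s z≤n)
    bound<n : bound j 0 true [] c < n
    bound<n = subst (_< n) (trans (sym (bound-product j 0 true [] c)) (*-identityʳ _)) small

  clique-forms : ∀ D → edgeSize D ≡ r → ∀ {S} → AllPairs (Realises D) S →
    ∀ {e f} → e ∈ S → f ∈ S → e ≢ f → Forms M e f (word D)
  clique-forms D size≡ clique e∈S f∈S e≢f with AllPairs-∈ clique e∈S f∈S e≢f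
  ... | inj₁ R = inj₁ (realises-pairWord D size≡ R)
  ... | inj₂ R = inj₂ (realises-pairWord D size≡ R)

-- Rational bounds

-- ℕtoℚ c in normal form, so that numerator and denominator compute.
ι : ℕ → ℚ
ι c = fromℤ (+ c)

ℕtoℚ≡ι : ∀ c → ℕtoℚ c ≡ ι c
ℕtoℚ≡ι c = ℚ.↥p/↧p≡p (ι c)

ι-* : ∀ a b → ι (a * b) ≡ ι a *ℚ ι b
ι-* a b = trans (sym (ℕtoℚ≡ι (a * b))) (cong (ℚ._/ 1) (ℤ.pos-* a b))

ι-mono-≤ : ∀ {a b} → a ≤ b → ι a ≤ℚ ι b
ι-mono-≤ {a} {b} a≤b = ℚ.*≤* (subst₂ ℤ._≤_ (sym (ℤ.*-identityʳ (+ a))) (sym (ℤ.*-identityʳ (+ b))) (+≤+ a≤b))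

ι-cancel-< : ∀ {a b} → ι a <ℚ ι b → a < b
ι-cancel-< {a} {b} (ℚ.*<* a<b) = ℤ.drop‿+<+ (subst₂ ℤ._<_ (ℤ.*-identityʳ (+ a)) (ℤ.*-identityʳ (+ b)) a<b)

ι-nonNegative : ∀ c → NonNegative (ι c)
ι-nonNegative c = ℚ.nonNegative (ι-mono-≤ {0} {c} z≤n)

-- The integer part of a rational, 0 for negative ones.
floorℕ : ℚ → ℕ
floorℕ (mkℚ (+ p) d _) = p / suc d
floorℕ (mkℚ -[1+ _ ] _ _) = 0

floorℕ-≤ : ∀ q → 0ℚ ≤ℚ q → ι (floorℕ q) ≤ℚ q
floorℕ-≤ (mkℚ (+ p) d _) _ = ℚ.*≤* (subst₂ ℤ._≤_ (ℤ.pos-* (p / suc d) (suc d)) (sym (ℤ.*-identityʳ (+ p)))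
  (+≤+ (m/n*n≤m p (suc d))))
floorℕ-≤ (mkℚ -[1+ _ ] _ _) (ℚ.*≤* ())

<-suc-floorℕ : ∀ q → 0ℚ ≤ℚ q → q <ℚ ι (suc (floorℕ q))
<-suc-floorℕ (mkℚ (+ p) d _) _ = ℚ.*<* (subst₂ ℤ._<_ (sym (ℤ.*-identityʳ (+ p))) (ℤ.pos-* (suc (p / suc d)) (suc d))
  (+<+ (≤-trans (≤-reflexive (cong suc (m≡m%n+[m/n]*n p (suc d)))) (+-monoˡ-≤ _ (m%n<n p (suc d))))))
<-suc-floorℕ (mkℚ -[1+ _ ] _ _) (ℚ.*≤* ())

pow½-positive : ∀ m → Positive (pow½ m)
pow½-positive zero = _
pow½-positive (suc m) = ℚ.pos*pos⇒pos ½ (pow½ m) {{pow½-positive m}}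

pow½-*-2^ : ∀ m → pow½ m *ℚ ι (2 ^ m) ≡ 1ℚ
pow½-*-2^ zero = refl
pow½-*-2^ (suc m) = begin
  (½ *ℚ pow½ m) *ℚ ι (2 * 2 ^ m)          ≡⟨ cong ((½ *ℚ pow½ m) *ℚ_) (ι-* 2 (2 ^ m)) ⟩
  (½ *ℚ pow½ m) *ℚ (ι 2 *ℚ ι (2 ^ m))     ≡⟨ interchange ½ (pow½ m) (ι 2) (ι (2 ^ m)) ⟩
  (½ *ℚ ι 2) *ℚ (pow½ m *ℚ ι (2 ^ m))     ≡⟨ cong (1ℚ *ℚ_) (pow½-*-2^ m) ⟩
  1ℚ                                  ∎
  where
  open ≡-Reasoning
  interchange : ∀ a b c d → (a *ℚ b) *ℚ (c *ℚ d) ≡ (a *ℚ c) *ℚ (b *ℚ d)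
  interchange a b c d = trans (ℚ.*-assoc a b (c *ℚ d)) (trans (cong (a *ℚ_) (trans (sym (ℚ.*-assoc b c d))
    (trans (cong (_*ℚ d) (ℚ.*-comm b c)) (ℚ.*-assoc c b d)))) (sym (ℚ.*-assoc a c (b *ℚ d))))

ι-*-2^-≤ : ∀ x c m → ι c ≤ℚ x *ℚ pow½ m → ι (c * 2 ^ m) ≤ℚ x
ι-*-2^-≤ x c m c≤x/2^m = begin
  ι (c * 2 ^ m)                  ≡⟨ ι-* c (2 ^ m) ⟩
  ι c *ℚ ι (2 ^ m)               ≤⟨ ℚ.*-monoʳ-≤-nonNeg (ι (2 ^ m)) {{ι-nonNegative (2 ^ m)}} c≤x/2^m ⟩
  (x *ℚ pow½ m) *ℚ ι (2 ^ m)     ≡⟨ ℚ.*-assoc x (pow½ m) (ι (2 ^ m)) ⟩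
  x *ℚ (pow½ m *ℚ ι (2 ^ m))     ≡⟨ cong (x *ℚ_) (pow½-*-2^ m) ⟩
  x *ℚ 1ℚ                        ≡⟨ ℚ.*-identityʳ x ⟩
  x                              ∎
  where open ℚ.≤-Reasoning

prodℚ-nonNegative : ∀ k (a : Fin k → ℚ) → (∀ i → 0ℚ ≤ℚ a i) → 0ℚ ≤ℚ prodℚ k a
prodℚ-nonNegative zero a _ = ι-mono-≤ {0} {1} z≤n
prodℚ-nonNegative (suc k) a 0≤a = ℚ.nonNegative⁻¹ _
  {{ℚ.nonNeg*nonNeg⇒nonNeg (a fzero) {{ℚ.nonNegative (0≤a fzero)}} (prodℚ k (a ∘ fsuc))
                           {{ℚ.nonNegative (prodℚ-nonNegative k (a ∘ fsuc) (0≤a ∘ fsuc))}}}}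

prodℚ-mono-≤ : ∀ k (a b : Fin k → ℚ) → (∀ i → 0ℚ ≤ℚ a i) → (∀ i → a i ≤ℚ b i) → prodℚ k a ≤ℚ prodℚ k b
prodℚ-mono-≤ zero a b _ _ = ℚ.≤-refl
prodℚ-mono-≤ (suc k) a b 0≤a a≤b = begin
  a fzero *ℚ prodℚ k (a ∘ fsuc)
    ≤⟨ ℚ.*-monoʳ-≤-nonNeg _ {{ℚ.nonNegative (prodℚ-nonNegative k (a ∘ fsuc) (0≤a ∘ fsuc))}} (a≤b fzero) ⟩
  b fzero *ℚ prodℚ k (a ∘ fsuc)
    ≤⟨ ℚ.*-monoˡ-≤-nonNeg (b fzero) {{ℚ.nonNegative (ℚ.≤-trans (0≤a fzero) (a≤b fzero))}}
         (prodℚ-mono-≤ k (a ∘ fsuc) (b ∘ fsuc) (0≤a ∘ fsuc) (a≤b ∘ fsuc)) ⟩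
  b fzero *ℚ prodℚ k (b ∘ fsuc) ∎
  where open ℚ.≤-Reasoning

ι-∏ : ∀ k (y : Fin k → ℕ) → ι (∏ y) ≡ prodℚ k (ι ∘ y)
ι-∏ zero y = refl
ι-∏ (suc k) y = trans (ι-* (y fzero) (∏ (y ∘ fsuc))) (cong (ι (y fzero) *ℚ_) (ι-∏ k (y ∘ fsuc)))

scaled-nonNegative : ∀ x m → 0ℚ <ℚ x → 0ℚ ≤ℚ x *ℚ pow½ m
scaled-nonNegative x m x>0 =
  ℚ.<⇒≤ (ℚ.positive⁻¹ (x *ℚ pow½ m) {{ℚ.pos*pos⇒pos x {{ℚ.positive x>0}} (pow½ m) {{pow½-positive m}}}})

floorℕ-<⇒< : ∀ x m {L} → 0ℚ <ℚ x → floorℕ (x *ℚ pow½ m) < L → x *ℚ pow½ m <ℚ ℕtoℚ L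
floorℕ-<⇒< x m {L} x>0 floor<L = begin-strict
  x *ℚ pow½ m                          <⟨ <-suc-floorℕ (x *ℚ pow½ m) (scaled-nonNegative x m x>0) ⟩
  ι (suc (floorℕ (x *ℚ pow½ m)))       ≤⟨ ι-mono-≤ floor<L ⟩
  ι L                                  ≡⟨ ℕtoℚ≡ι L ⟨
  ℕtoℚ L                               ∎
  where open ℚ.≤-Reasoning

∏-floorℕ-< : ∀ k n (x : Fin k → ℚ) (m : Fin k → ℕ) → (∀ i → 0ℚ <ℚ x i) → prodℚ k x <ℚ ℕtoℚ n →
  ∏ (λ i → floorℕ (x i *ℚ pow½ (m i)) * 2 ^ m i) < n
∏-floorℕ-< k n x m x>0 x<n = ι-cancel-< (begin-strict
  ι (∏ y)             ≡⟨ ι-∏ k y ⟩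
  prodℚ k (ι ∘ y)     ≤⟨ prodℚ-mono-≤ k (ι ∘ y) x (λ i → ι-mono-≤ z≤n)
                           (λ i → ι-*-2^-≤ (x i) _ (m i) (floorℕ-≤ _ (scaled-nonNegative (x i) (m i) (x>0 i)))) ⟩
  prodℚ k x           <⟨ x<n ⟩
  ℕtoℚ n              ≡⟨ ℕtoℚ≡ι n ⟩
  ι n                 ∎)
  where
  open ℚ.≤-Reasoning
  y : Fin k → ℕ
  y i = floorℕ (x i *ℚ pow½ (m i)) * 2 ^ m i
injective⇒onto : ∀ {N} (π : Fin N → Fin N) → Injective _≡_ _≡_ π → ∀ y → ∃ λ x → π x ≡ y
injective⇒onto {suc N} π π-injective y with any? (λ x → π x ≟ y)
... | yes hit = hit
... | no miss = contradiction (injective⇒≤ {f = squeeze} squeeze-injective) (<-irrefl refl)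
  where
  π≢y : ∀ x → y ≢ π x
  π≢y x y≡πx = miss (x , sym y≡πx)
  squeeze : Fin (suc N) → Fin N
  squeeze x = punchOut (π≢y x)
  squeeze-injective : Injective _≡_ _≡_ squeeze
  squeeze-injective eq = π-injective (punchOut-injective (π≢y _) (π≢y _) eq)

∏-injective : ∀ {N} (π : Fin N → Fin N) → Injective _≡_ _≡_ π → (y : Fin N → ℕ) → ∏ (y ∘ π) ≡ ∏ y
∏-injective π π-injective y =
  sym (∏-permute y (permutation π (proj₁ ∘ onto) (proj₂ ∘ onto) (λ x → π-injective (proj₂ (onto (π x))))))
  where
  onto : ∀ y → ∃ λ x → π x ≡ y
  onto = injective⇒onto π π-injective

module LeafIndexing (j : ℕ) (P : Fin (3 ^ j) → List Bool)
  (complete : ∀ w → IsPattern (suc j) w → Collectable (suc j) w → ∃ λ i → P i ≡ w) where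

  leaf : Fin (3 ^ j) → Shape
  leaf = leafShape j 0 true []

  leaf-edgeSize : ∀ ℓ → edgeSize (leaf ℓ) ≡ suc j
  leaf-edgeSize = leafShape-edgeSize j 0 true []

  found : ∀ ℓ → ∃ λ i → P i ≡ word (leaf ℓ)
  found ℓ = complete (word (leaf ℓ))
    (subst (λ r → IsPattern r (word (leaf ℓ))) (leaf-edgeSize ℓ)
      (word-isPattern (leaf ℓ) (leafShape-startsWithA j 0 true [] ℓ refl)))
    (subst (λ r → Collectable r (word (leaf ℓ))) (leaf-edgeSize ℓ) (word-collectable (leaf ℓ)))

  index : Fin (3 ^ j) → Fin (3 ^ j)
  index = proj₁ ∘ found

  P∘index : ∀ ℓ → P (index ℓ) ≡ word (leaf ℓ)
  P∘index = proj₂ ∘ found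

  index-injective : Injective _≡_ _≡_ index
  index-injective {a} {b} eq = leafShape-injective j 0 true []
    (word-injective (leaf a) (leaf b) (trans (sym (P∘index a)) (trans (cong P eq) (P∘index b))))

theorem2p5 : (r : ℕ) → 2 ≤ r →
    (P : Fin (3 ^ (r ∸ 1)) → List Bool) →
    (∀ i → IsPattern r (P i) × Collectable r (P i)) →
    Injective _≡_ _≡_ P →
    (∀ w → IsPattern r w → Collectable r w → ∃ λ i → P i ≡ w) →
    (x : Fin (3 ^ (r ∸ 1)) → ℚ) → (∀ i → 0ℚ <ℚ x i) →
    (n : ℕ) → prodℚ (3 ^ (r ∸ 1)) x <ℚ ℕtoℚ n →
    (M : Fin (r * n) → Fin n) → IsMatching r n M →
    ∃ λ (i : Fin (3 ^ (r ∸ 1))) → Σ (List (Fin n)) λ S →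
      Unique S ×
      (∀ {e f} → e ∈ S → f ∈ S → e ≢ f → Forms M e f (P i)) ×
      (x i *ℚ pow½ (maturity (P i)) <ℚ ℕtoℚ (length S))
-- The leaf words are 3^(r-1) distinct collectable patterns, so completeness alone makes P a
-- bijection onto them.
theorem2p5 (suc j) (s≤s _) P _ _ complete x x>0 n prod<n M matching =
  finish (matching⇒leafClique j refl c small)
  where
  open Matching M matching
  open LeafIndexing j P complete
  m : Fin (3 ^ j) → ℕ
  m i = maturity (P i)
  c : Fin (3 ^ j) → ℕ
  c ℓ = floorℕ (x (index ℓ) *ℚ pow½ (m (index ℓ)))
  small : ∏ (λ ℓ → c ℓ * 2 ^ maturity (word (leaf ℓ))) < n
  small = subst (_< n)
    (trans (sym (∏-injective index index-injective _)) (∏-cong (λ ℓ → cong (λ w → c ℓ * 2 ^ maturity w) (P∘index ℓ))))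
    (∏-floorℕ-< _ n x m x>0 prod<n)
  finish : LeafClique j 0 true [] c → ∃ λ (i : Fin (3 ^ j)) → Σ (List (Fin n)) λ S →
    Unique S × (∀ {e f} → e ∈ S → f ∈ S → e ≢ f → Forms M e f (P i)) ×
    (x i *ℚ pow½ (maturity (P i)) <ℚ ℕtoℚ (length S))
  finish (ℓ , S , clique , big) = index ℓ , S , AllPairs.map (realises-≢ (leaf ℓ)) clique ,
    (λ e∈S f∈S e≢f → subst (Forms M _ _) (sym (P∘index ℓ))
                            (clique-forms (leaf ℓ) (leaf-edgeSize ℓ) clique e∈S f∈S e≢f)) ,
    floorℕ-<⇒< (x (index ℓ)) (m (index ℓ)) (x>0 (index ℓ)) big
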